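{- Let $n\geq 20$ and let $G$ be an $n$-vertex $C_3\cup C_4$-free plane graph whose number of edges is maximum among all $n$-vertex $C_3\cup C_4$-free plane graphs. Then for any two independent (i.e., vertex-disjoint) edges $e,f\in E_I(G)$, we have $|V(\Theta_e)\cap V(\Theta_f)|\geq 2$.
   Context: All graphs are simple. $C_3\cup C_4$ denotes the vertex-disjoint union of a cycle of length 3 and a cycle of length 4; a graph is $C_3\cup C_4$-free if it has no subgraph isomorphic to $C_3\cup C_4$. For a plane graph $G$, an edge $e$ is an interior edge if it lies in the boundaries of exactly two $3$-faces $F_1,F_2$ of $G$; $E_I(G)$ is the set of interior edges, and for $e\in E_I(G)$, $\Theta_e$ denotes the subgraph $F_1\cup F_2$ formed by the boundaries of these two $3$-faces. -}

module Defs where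

open import Data.Nat using (ℕ; zero; suc; _+_; _*_; _≤_; _<ᵇ_; _≤ᵇ_)
open import Data.Bool using (Bool; true; false; _∧_; _∨_; not; if_then_else_)
open import Data.Fin using (Fin; toℕ; _≟_)
open import Data.Fin.Patterns using (0F; 1F; 2F; 3F; 4F; 5F; 6F)
open import Data.List using (List; allFin; upTo; map)
open import Data.Nat.ListAction using (sum)
open import Data.Bool.ListAction using (any; all)
open import Data.Product using (Σ; _×_; _,_; proj₁; ∃)
open import Data.Sum using (_⊎_)
open import Relation.Nullary using (¬_)
open import Relation.Nullary.Decidable using (⌊_⌋)
open import Relation.Binary.PropositionalEquality using (_≡_; _≢_)
open import Function.Definitions using (Injective)

-- Simple graphs on vertex set Fin n, given by a Boolean adjacency
-- function (symmetry and irreflexivity are imposed in PlaneGraph).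

Adjacency : ℕ → Set
Adjacency n = Fin n → Fin n → Bool

iter : {A : Set} → (A → A) → ℕ → A → A
iter f zero    x = x
iter f (suc k) x = f (iter f k x)

b2n : Bool → ℕ
b2n true  = 1
b2n false = 0

countFin : (n : ℕ) → (Fin n → Bool) → ℕ
countFin n p = sum (map (λ i → b2n (p i)) (allFin n))

_==_ : {n : ℕ} → Fin n → Fin n → Bool
u == v = ⌊ u ≟ v ⌋

edgeCount : {n : ℕ} → Adjacency n → ℕ
edgeCount {n} adj =
  sum (map (λ u → countFin n (λ v → (toℕ u <ᵇ toℕ v) ∧ adj u v)) (allFin n))

-- Combinatorial embedding (rotation system).  rot v : the cyclic
-- successor of a neighbour in the cyclic order of the neighbours of v.
-- Darts are ordered pairs (u , v) with u adjacent to v.  The face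
-- permutation sends the dart (u , v) to (v , rot v u); faces are its
-- orbits on darts.

Dart : ℕ → Set
Dart n = Fin n × Fin n

faceStep : {n : ℕ} → (Fin n → Fin n → Fin n) → Dart n → Dart n
faceStep rot (u , v) = (v , rot v u)

dartKey : {n : ℕ} → Dart n → ℕ
dartKey {n} (u , v) = toℕ u * n + toℕ v

-- a dart is the representative of its face if it has the least key in
-- its orbit (every orbit has length at most n * n)
isFaceRep : {n : ℕ} → Adjacency n → (Fin n → Fin n → Fin n) → Dart n → Bool
isFaceRep {n} adj rot (u , v) =
  adj u v ∧ all (λ k → (dartKey (u , v) ≤ᵇ dartKey (iter (faceStep rot) k (u , v)))) (upTo (n * n))

faceCount : {n : ℕ} → Adjacency n → (Fin n → Fin n → Fin n) → ℕ
faceCount {n} adj rot =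
  sum (map (λ u → countFin n (λ v → isFaceRep adj rot (u , v))) (allFin n))

reachB : {n : ℕ} → Adjacency n → ℕ → Fin n → Fin n → Bool
reachB adj zero    u v = u == v
reachB {n} adj (suc k) u v =
  reachB adj k u v ∨ any (λ w → reachB adj k u w ∧ adj w v) (allFin n)

hasNeighbour : {n : ℕ} → Adjacency n → Fin n → Bool
hasNeighbour {n} adj v = any (adj v) (allFin n)

nontrivVertexCount : {n : ℕ} → Adjacency n → ℕ
nontrivVertexCount {n} adj = countFin n (hasNeighbour adj)

-- number of connected components having at least one edge
-- (counted via their least vertex)
nontrivComponentCount : {n : ℕ} → Adjacency n → ℕ
nontrivComponentCount {n} adj =
  countFin n (λ v → hasNeighbour adj v ∧
                     not (any (λ u → (toℕ u <ᵇ toℕ v) ∧ reachB adj n u v) (allFin n)))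

-- A plane graph on n vertices: a simple graph together with a rotation
-- system of genus 0 (every non-trivial component satisfies Euler's
-- formula V - E + F = 2; summed: V' + F = E + 2 c').

record PlaneGraph (n : ℕ) : Set where
  field
    adj     : Adjacency n
    sym     : ∀ u v → adj u v ≡ adj v u
    irrefl  : ∀ u → adj u u ≡ false
    rot     : Fin n → Fin n → Fin n
    rot-adj : ∀ v u → adj v u ≡ true → adj v (rot v u) ≡ true
    rot-inj : ∀ v u u′ → adj v u ≡ true → adj v u′ ≡ true →
              rot v u ≡ rot v u′ → u ≡ u′
    rot-cyc : ∀ v u w → adj v u ≡ true → adj v w ≡ true →
              ∃ λ k → iter (rot v) k u ≡ w
    euler   : nontrivVertexCount adj + faceCount adj rot
              ≡ edgeCount adj + 2 * nontrivComponentCount adj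

open PlaneGraph public

ContainsC3∪C4 : {n : ℕ} → Adjacency n → Set
ContainsC3∪C4 {n} adj =
  Σ (Fin 7 → Fin n) λ h → Injective _≡_ _≡_ h ×
    (adj (h 0F) (h 1F) ≡ true × adj (h 1F) (h 2F) ≡ true × adj (h 2F) (h 0F) ≡ true ×
     adj (h 3F) (h 4F) ≡ true × adj (h 4F) (h 5F) ≡ true ×
     adj (h 5F) (h 6F) ≡ true × adj (h 6F) (h 3F) ≡ true)

C3∪C4-free : {n : ℕ} → Adjacency n → Set
C3∪C4-free adj = ¬ ContainsC3∪C4 adj

IsExtremal : {n : ℕ} → PlaneGraph n → Set
IsExtremal {n} G = C3∪C4-free (adj G) ×
  (∀ (H : PlaneGraph n) → C3∪C4-free (adj H) → edgeCount (adj H) ≤ edgeCount (adj G))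

-- the dart d lies on a face of length 3 (in a simple graph a closed
-- face walk of length 3 is a triangle; length 1 is impossible)
OnThreeFace : {n : ℕ} → PlaneGraph n → Dart n → Set
OnThreeFace G (u , v) =
  adj G u v ≡ true × iter (faceStep (rot G)) 3 (u , v) ≡ (u , v)

-- the edge uv is interior: both faces incident with it (the faces of
-- the darts (u,v) and (v,u), which are distinct 3-faces) are 3-faces
InteriorEdge : {n : ℕ} → PlaneGraph n → Fin n → Fin n → Set
InteriorEdge G u v = OnThreeFace G (u , v) × OnThreeFace G (v , u)

OnFaceOf : {n : ℕ} → PlaneGraph n → Dart n → Fin n → Set
OnFaceOf G d z = Σ (Fin 3) λ k → proj₁ (iter (faceStep (rot G)) (toℕ k) d) ≡ z

InTheta : {n : ℕ} → PlaneGraph n → Fin n → Fin n → Fin n → Set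
InTheta G u v z = OnFaceOf G (u , v) z ⊎ OnFaceOf G (v , u) z

ThetaMeetTwice : {n : ℕ} → PlaneGraph n → Fin n → Fin n → Fin n → Fin n → Set
ThetaMeetTwice G u v x y =
  Σ _ λ a → Σ _ λ b → a ≢ b ×
    InTheta G u v a × InTheta G x y a × InTheta G u v b × InTheta G x y b

{-# OPTIONS --safe #-}
-- The two faces at an interior edge uv are triangles u v a and v u b, with a = rot v u and
-- b = rot u v. If a ≢ b, Θ = {u, a, v, b} is a diamond (K₄ minus ab): it contains the triangles
-- uva, uvb and the 4-cycle u a v b. If a ≡ b, the rotation at each of u, v, a swaps the other two,
-- so {u, v, a} is a whole component. When two diamonds share at most one vertex, a triangle of one
-- avoids the 4-cycle of the other, giving C₃ ∪ C₄; the same happens for a triangle component next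
-- to a diamond. If both Θ are triangle components, adding an edge between them (inserted into both
-- rotations) merges two faces and two components, so Euler's formula still holds, and it lies on
-- no cycle of length 3 or 4: a C₃ ∪ C₄-free plane graph with one more edge.
module Submission where

open import Defs renaming (sym to adj-sym; irrefl to adj-irrefl)
open import Data.Nat using (ℕ; zero; suc; _+_; _*_; _∸_; _≤_; _<_; _<ᵇ_; _≤ᵇ_; z≤n; s≤s; _≤?_)
open import Data.Nat.Properties hiding (_≟_)
open import Data.Nat.ListAction using (sum)
open import Data.Nat.ListAction.Properties using (sum-++)
open import Data.Nat.Tactic.RingSolver using (solve-∀)
open import Data.Bool using (Bool; true; false; _∧_; _∨_; not; if_then_else_)
open import Data.Bool.Properties using (T-≡; ¬-not; not-injective; ∨-comm; ∧-comm; ∨-zeroʳ; ∨-identityʳ)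
open import Data.Bool.ListAction using (any; all; or; and)
open import Data.Fin using (Fin; zero; suc; toℕ; _≟_; combine)
open import Data.Fin.Patterns using (0F; 1F; 2F; 3F; 4F; 5F; 6F)
import Data.Fin.Properties as Fin
open import Data.List using (List; []; _∷_; _++_; allFin; upTo; map; tabulate; applyUpTo)
open import Data.List.Properties using (map-cong; map-cong-local; map-tabulate; tabulate-cong; map-++)
open import Data.List.Relation.Unary.Any using (here; there; any?)
open import Data.List.Relation.Unary.All using (All; []; _∷_)
import Data.List.Relation.Unary.All as All
open import Data.List.Relation.Unary.AllPairs using (AllPairs; []; _∷_)
import Data.List.Relation.Unary.AllPairs as AllPairs
open import Data.List.Membership.Propositional using (_∈_; _∉_; find; lose)
open import Data.List.Membership.Propositional.Properties using (∈-allFin; ∈-upTo⁺; ∈-applyUpTo⁺; ∈-applyUpTo⁻)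
open import Data.Vec using (lookup; []; _∷_)
open import Data.Vec.Relation.Unary.All using ([]; _∷_)
open import Data.Vec.Relation.Unary.AllPairs using ([]; _∷_)
open import Data.Vec.Relation.Unary.Unique.Propositional using (Unique)
open import Data.Vec.Relation.Unary.Unique.Propositional.Properties using (lookup-injective)
open import Data.Product using (_×_; _,_; proj₁; proj₂; ∃; ∃₂)
open import Data.Product.Properties using (,-injectiveˡ; ,-injectiveʳ)
open import Data.Sum using (_⊎_; inj₁; inj₂; map₂; [_,_]′)
open import Data.Empty using (⊥; ⊥-elim)
open import Function using (_∘_)
open import Function.Bundles using (Equivalence)
open import Relation.Nullary using (¬_; Dec; yes; no; ¬?; _×-dec_)
open import Relation.Nullary.Decidable using (toWitness)
open import Relation.Binary.Definitions using (tri<; tri≈; tri>)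
open import Relation.Binary.PropositionalEquality using (_≡_; _≢_; refl; sym; trans; cong; cong₂; subst; module ≡-Reasoning)

true≢false : true ≢ false
true≢false ()

==-refl : {n : ℕ} (a : Fin n) → (a == a) ≡ true
==-refl a with a ≟ a
... | yes _  = refl
... | no a≢a = ⊥-elim (a≢a refl)

==-≢ : {n : ℕ} {a b : Fin n} → a ≢ b → (a == b) ≡ false
==-≢ {a = a} {b} a≢b with a ≟ b
... | yes a≡b = ⊥-elim (a≢b a≡b)
... | no _    = refl

==⇒≡ : {n : ℕ} {a b : Fin n} → (a == b) ≡ true → a ≡ b
==⇒≡ {a = a} {b} e = toWitness {a? = a ≟ b} (Equivalence.from T-≡ e)

∧-true : {a b : Bool} → (a ∧ b) ≡ true → a ≡ true × b ≡ true
∧-true {true} e = refl , e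

∧-intro : {a b : Bool} → a ≡ true → b ≡ true → (a ∧ b) ≡ true
∧-intro refl refl = refl

∨-introˡ : {a b : Bool} → a ≡ true → (a ∨ b) ≡ true
∨-introˡ refl = refl

∨-introʳ : {a b : Bool} → b ≡ true → (a ∨ b) ≡ true
∨-introʳ {a} refl = ∨-zeroʳ a

∨-true : {a b : Bool} → (a ∨ b) ≡ true → a ≡ true ⊎ b ≡ true
∨-true {true}  _ = inj₁ refl
∨-true {false} e = inj₂ e

true-ext : {a b : Bool} → (a ≡ true → b ≡ true) → (b ≡ true → a ≡ true) → a ≡ b
true-ext {true}  {true}  _ _ = refl
true-ext {true}  {false} f _ = sym (f refl)
true-ext {false} {true}  _ g = g refl
true-ext {false} {false} _ _ = refl

≤ᵇ-sound : ∀ a b → (a ≤ᵇ b) ≡ true → a ≤ b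
≤ᵇ-sound a b e = ≤ᵇ⇒≤ a b (Equivalence.from T-≡ e)

≤ᵇ-complete : {a b : ℕ} → a ≤ b → (a ≤ᵇ b) ≡ true
≤ᵇ-complete le = Equivalence.to T-≡ (≤⇒≤ᵇ le)

<ᵇ-sound : ∀ a b → (a <ᵇ b) ≡ true → a < b
<ᵇ-sound a b e = <ᵇ⇒< a b (Equivalence.from T-≡ e)

<ᵇ-complete : {a b : ℕ} → a < b → (a <ᵇ b) ≡ true
<ᵇ-complete lt = Equivalence.to T-≡ (<⇒<ᵇ lt)

module _ {A : Set} (p : A → Bool) where

  any-sound : (xs : List A) → any p xs ≡ true → ∃ λ x → x ∈ xs × p x ≡ true
  any-sound (x ∷ xs) e with p x in px
  ... | true  = x , here refl , px
  ... | false with any-sound xs e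
  ...   | y , y∈xs , py = y , there y∈xs , py

  any-complete : {xs : List A} {x : A} → x ∈ xs → p x ≡ true → any p xs ≡ true
  any-complete {y ∷ _} (here refl) px rewrite px = refl
  any-complete {y ∷ _} (there x∈xs) px = ∨-introʳ {p y} (any-complete x∈xs px)

  all-sound : {xs : List A} → all p xs ≡ true → ∀ {x} → x ∈ xs → p x ≡ true
  all-sound e (here refl)  = proj₁ (∧-true e)
  all-sound e (there x∈xs) = all-sound (proj₂ (∧-true e)) x∈xs

  all-complete : (xs : List A) → (∀ {x} → x ∈ xs → p x ≡ true) → all p xs ≡ true
  all-complete []       _ = refl
  all-complete (x ∷ xs) h = ∧-intro (h (here refl)) (all-complete xs (h ∘ there))

any-cong : {A : Set} {p q : A → Bool} (xs : List A) → (∀ x → p x ≡ q x) → any p xs ≡ any q xs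
any-cong xs p≗q = cong or (map-cong p≗q xs)

all-cong : {A : Set} {p q : A → Bool} (xs : List A) → (∀ x → p x ≡ q x) → all p xs ≡ all q xs
all-cong xs p≗q = cong and (map-cong p≗q xs)

sumMap : {A : Set} → (A → ℕ) → List A → ℕ
sumMap f xs = sum (map f xs)

sumFin : (n : ℕ) → (Fin n → ℕ) → ℕ
sumFin n f = sumMap f (allFin n)

sumMap-cong : {A : Set} {f g : A → ℕ} {xs : List A} → All (λ x → f x ≡ g x) xs → sumMap f xs ≡ sumMap g xs
sumMap-cong fg = cong sum (map-cong-local fg)

sumMap-++ : {A : Set} (f : A → ℕ) (xs ys : List A) → sumMap f (xs ++ ys) ≡ sumMap f xs + sumMap f ys
sumMap-++ f xs ys = trans (cong sum (map-++ f xs ys)) (sum-++ (map f xs) (map f ys))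

sumMap-zero : {A : Set} (xs : List A) → sumMap (λ _ → 0) xs ≡ 0
sumMap-zero []       = refl
sumMap-zero (_ ∷ xs) = sumMap-zero xs

sumFin-cong : (n : ℕ) {f g : Fin n → ℕ} → (∀ i → f i ≡ g i) → sumFin n f ≡ sumFin n g
sumFin-cong n fg = cong sum (map-cong fg (allFin n))

+-trade : {a b c d e x y : ℕ} → a + c ≡ b + d → b + y ≡ e + x → a + (c + y) ≡ e + (d + x)
+-trade {a} {b} {c} {d} {e} {x} {y} p q = begin
  a + (c + y) ≡⟨ +-assoc a c y ⟨
  a + c + y   ≡⟨ cong (_+ y) p ⟩
  b + d + y   ≡⟨ swap b d y ⟩
  b + y + d   ≡⟨ cong (_+ d) q ⟩
  e + x + d   ≡⟨ swap′ e x d ⟩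
  e + (d + x) ∎
  where
  open ≡-Reasoning
  swap : ∀ b d y → b + d + y ≡ b + y + d
  swap = solve-∀
  swap′ : ∀ e x d → e + x + d ≡ e + (d + x)
  swap′ = solve-∀

sum-tabulate-update : {n : ℕ} (f g : Fin n → ℕ) (j : Fin n) → (∀ i → i ≢ j → f i ≡ g i) →
                      sum (tabulate f) + g j ≡ sum (tabulate g) + f j
sum-tabulate-update {suc n} f g zero fg = begin
  f zero + sum (tabulate (f ∘ suc)) + g zero ≡⟨ cong (λ s → f zero + s + g zero) rest ⟩
  f zero + sum (tabulate (g ∘ suc)) + g zero ≡⟨ swap (f zero) _ (g zero) ⟩
  g zero + sum (tabulate (g ∘ suc)) + f zero ∎
  where
  open ≡-Reasoning
  rest : sum (tabulate (f ∘ suc)) ≡ sum (tabulate (g ∘ suc))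
  rest = cong sum (tabulate-cong (λ i → fg (suc i) λ ()))
  swap : ∀ a b c → a + b + c ≡ c + b + a
  swap = solve-∀
sum-tabulate-update {suc n} f g (suc j) fg = begin
  f zero + sum (tabulate (f ∘ suc)) + g (suc j)   ≡⟨ +-assoc (f zero) _ _ ⟩
  f zero + (sum (tabulate (f ∘ suc)) + g (suc j)) ≡⟨ cong₂ _+_ (fg zero λ ()) ih ⟩
  g zero + (sum (tabulate (g ∘ suc)) + f (suc j)) ≡⟨ +-assoc (g zero) _ _ ⟨
  g zero + sum (tabulate (g ∘ suc)) + f (suc j)   ∎
  where
  open ≡-Reasoning
  ih : sum (tabulate (f ∘ suc)) + g (suc j) ≡ sum (tabulate (g ∘ suc)) + f (suc j)
  ih = sum-tabulate-update (f ∘ suc) (g ∘ suc) j (λ i i≢j → fg (suc i) (i≢j ∘ Fin.suc-injective))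

sumFin-update : (n : ℕ) (f g : Fin n → ℕ) (j : Fin n) → (∀ i → i ≢ j → f i ≡ g i) →
                sumFin n f + g j ≡ sumFin n g + f j
sumFin-update n f g j fg
  rewrite map-tabulate (λ i → i) f | map-tabulate (λ i → i) g = sum-tabulate-update f g j fg

sumFin-update-list : (n : ℕ) (f g : Fin n → ℕ) (Ls : List (Fin n)) → AllPairs _≢_ Ls →
                     (∀ i → i ∉ Ls → f i ≡ g i) → sumFin n f + sumMap g Ls ≡ sumFin n g + sumMap f Ls
sumFin-update-list n f g []       _             fg = cong (_+ 0) (sumFin-cong n (λ i → fg i λ ()))
sumFin-update-list n f g (s ∷ Ls) (s∉Ls ∷ Ls!) fg =
  +-trade {a = sumFin n f} {x = sumMap f Ls} {y = sumMap g Ls} at-s (trans ih (cong (sumFin n g +_) off-s))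
  where
  f′ : Fin n → ℕ
  f′ i = if i == s then g s else f i
  f′-≢ : ∀ i → i ≢ s → f′ i ≡ f i
  f′-≢ i i≢s rewrite ==-≢ i≢s = refl
  at-s : sumFin n f + g s ≡ sumFin n f′ + f s
  at-s = subst (λ t → sumFin n f + t ≡ sumFin n f′ + f s) (cong (if_then g s else f s) (==-refl s))
           (sumFin-update n f f′ s (λ i i≢s → sym (f′-≢ i i≢s)))
  ih : sumFin n f′ + sumMap g Ls ≡ sumFin n g + sumMap f′ Ls
  ih = sumFin-update-list n f′ g Ls Ls! λ i i∉Ls → f′-out i i∉Ls
    where
    f′-out : ∀ i → i ∉ Ls → f′ i ≡ g i
    f′-out i i∉Ls with i ≟ s
    ... | yes refl = refl
    ... | no i≢s   = fg i λ { (here i≡s) → i≢s i≡s ; (there i∈Ls) → i∉Ls i∈Ls }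
  off-s : sumMap f′ Ls ≡ sumMap f Ls
  off-s = sumMap-cong (All.map (λ s≢i → f′-≢ _ (s≢i ∘ sym)) s∉Ls)

sumFin-support : (n : ℕ) (f : Fin n → ℕ) (Ls : List (Fin n)) → AllPairs _≢_ Ls →
                 (∀ i → i ∉ Ls → f i ≡ 0) → sumFin n f ≡ sumMap f Ls
sumFin-support n f Ls Ls! f0 = begin
  sumFin n f                       ≡⟨ +-identityʳ _ ⟨
  sumFin n f + 0                   ≡⟨ cong (sumFin n f +_) (sumMap-zero Ls) ⟨
  sumFin n f + sumMap (λ _ → 0) Ls ≡⟨ sumFin-update-list n f (λ _ → 0) Ls Ls! f0 ⟩
  sumFin n (λ _ → 0) + sumMap f Ls ≡⟨ cong (_+ sumMap f Ls) (sumMap-zero (allFin n)) ⟩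
  sumMap f Ls                      ∎
  where open ≡-Reasoning

countFin-support : (n : ℕ) (p : Fin n → Bool) (Ls : List (Fin n)) → AllPairs _≢_ Ls →
                   (∀ i → p i ≡ true → i ∈ Ls) → countFin n p ≡ sumMap (b2n ∘ p) Ls
countFin-support n p Ls Ls! supp = sumFin-support n (b2n ∘ p) Ls Ls! off
  where
  off : ∀ i → i ∉ Ls → b2n (p i) ≡ 0
  off i i∉Ls with p i in pi
  ... | true  = ⊥-elim (i∉Ls (supp i pi))
  ... | false = refl

sumMap-b2n-false : {A : Set} (P : A → Bool) {xs : List A} → All (λ x → P x ≡ false) xs → sumMap (b2n ∘ P) xs ≡ 0
sumMap-b2n-false P []         = refl
sumMap-b2n-false P (px ∷ pxs) rewrite px = sumMap-b2n-false P pxs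

sumMap-b2n-single : {A : Set} (P : A → Bool) (R : A → A → Set) {xs : List A} → AllPairs R xs →
                    (∀ {a b} → a ∈ xs → b ∈ xs → P a ≡ true → P b ≡ true → ¬ R a b) →
                    {m : A} → m ∈ xs → P m ≡ true → sumMap (b2n ∘ P) xs ≡ 1
sumMap-b2n-single P R (Rx ∷ _) excl (here refl) Pm rewrite Pm =
  cong suc (sumMap-b2n-false P (All.tabulate λ b∈ → ¬-not λ Pb → excl (here refl) (there b∈) Pm Pb (All.lookup Rx b∈)))
sumMap-b2n-single P R {x ∷ _} (Rx ∷ Rxs) excl (there m∈xs) Pm with P x in Px
... | true  = ⊥-elim (excl (here refl) (there m∈xs) Px Pm (All.lookup Rx m∈xs))
... | false = sumMap-b2n-single P R Rxs (λ a∈ b∈ → excl (there a∈) (there b∈)) m∈xs Pm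

argmin : {A : Set} (κ : A → ℕ) (xs : List A) {x : A} → x ∈ xs →
         ∃ λ m → m ∈ xs × (∀ {b} → b ∈ xs → κ m ≤ κ b)
argmin κ (a ∷ [])     _ = a , here refl , λ { (here refl) → ≤-refl }
argmin κ (a ∷ c ∷ xs) _ with argmin κ (c ∷ xs) (here refl)
... | m , m∈ , m≤ with κ a ≤? κ m
...   | yes a≤m = a , here refl , λ { (here refl) → ≤-refl ; (there b∈) → ≤-trans a≤m (m≤ b∈) }
...   | no  a≰m = m , there m∈ , λ { (here refl) → <⇒≤ (≰⇒> a≰m) ; (there b∈) → m≤ b∈ }

count-minimum : {A : Set} (κ : A → ℕ) (xs : List A) → AllPairs (λ a b → κ a ≢ κ b) xs →
                {x : A} → x ∈ xs → sumMap (λ a → b2n (all (λ b → κ a ≤ᵇ κ b) xs)) xs ≡ 1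
count-minimum {A} κ xs xs! x∈xs with argmin κ xs x∈xs
... | m , m∈xs , m≤ =
  sumMap-b2n-single IsMin (λ a b → κ a ≢ κ b) xs! excl m∈xs (all-complete _ xs (≤ᵇ-complete ∘ m≤))
  where
  IsMin : A → Bool
  IsMin a = all (λ b → κ a ≤ᵇ κ b) xs
  excl : ∀ {a b} → a ∈ xs → b ∈ xs → IsMin a ≡ true → IsMin b ≡ true → ¬ (κ a ≢ κ b)
  excl {a} {b} a∈ b∈ a-min b-min κa≢κb =
    κa≢κb (≤-antisym (≤ᵇ-sound (κ a) (κ b) (all-sound _ a-min b∈)) (≤ᵇ-sound (κ b) (κ a) (all-sound _ b-min a∈)))

-- Reachability and connected components

_∈?_ : {n : ℕ} (p : Fin n) (Ls : List (Fin n)) → Dec (p ∈ Ls)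
p ∈? Ls = any? (p ≟_) Ls

module _ {n : ℕ} (X : Adjacency n) where

  reach-refl : ∀ k p → reachB X k p p ≡ true
  reach-refl zero    p = ==-refl p
  reach-refl (suc k) p = ∨-introˡ (reach-refl k p)

  reach-≤ : ∀ {k m p q} → k ≤ m → reachB X k p q ≡ true → reachB X m p q ≡ true
  reach-≤ {m = m} k≤m r with m≤n⇒m<n∨m≡n k≤m
  ... | inj₂ refl = r
  reach-≤ {m = suc m} k≤m r | inj₁ k<1+m = ∨-introˡ (reach-≤ (≤-pred k<1+m) r)

  reach-step : ∀ k {p w q} → reachB X k p w ≡ true → X w q ≡ true → reachB X (suc k) p q ≡ true
  reach-step k {p} {w} {q} r e =
    ∨-introʳ {reachB X k p q} (any-complete _ (∈-allFin w) (∧-intro r e))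

  reach-edge : ∀ {p q} → X p q ≡ true → reachB X 1 p q ≡ true
  reach-edge {p} = reach-step 0 (reach-refl 0 p)

  reach-++ : ∀ k m {p w q} → reachB X k p w ≡ true → reachB X m w q ≡ true → reachB X (m + k) p q ≡ true
  reach-++ k zero    r₁ r₂ rewrite ==⇒≡ r₂ = r₁
  reach-++ k (suc m) {p} {w} {q} r₁ r₂ with ∨-true {reachB X m w q} r₂
  ... | inj₁ r = ∨-introˡ (reach-++ k m r₁ r)
  ... | inj₂ e with any-sound _ (allFin n) e
  ...   | t , _ , rt = reach-step (m + k) (reach-++ k m r₁ (proj₁ (∧-true rt))) (proj₂ (∧-true rt))

  reach-closed : (C : Fin n → Set) → (∀ {a b} → C a → X a b ≡ true → C b) →
                 ∀ k {p q} → reachB X k p q ≡ true → C p → C q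
  reach-closed C closed zero r Cp = subst C (==⇒≡ r) Cp
  reach-closed C closed (suc k) {p} {q} r Cp with ∨-true {reachB X k p q} r
  ... | inj₁ r′ = reach-closed C closed k r′ Cp
  ... | inj₂ e with any-sound _ (allFin n) e
  ...   | w , _ , rw = closed (reach-closed C closed k (proj₁ (∧-true rw)) Cp) (proj₂ (∧-true rw))

reach-agree : {n : ℕ} (X Y : Adjacency n) (C : Fin n → Set) →
              (∀ {a b} → C a → X a b ≡ true → C b) → (∀ {a} b → C a → X a b ≡ Y a b) →
              ∀ k {p} q → C p → reachB X k p q ≡ reachB Y k p q
reach-agree X Y C closed agree zero    q Cp = refl
reach-agree {n} X Y C closed agree (suc k) {p} q Cp =
  cong₂ _∨_ (reach-agree X Y C closed agree k q Cp) (any-cong (allFin n) via)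
  where
  via : ∀ w → (reachB X k p w ∧ X w q) ≡ (reachB Y k p w ∧ Y w q)
  via w with reachB X k p w in r | reach-agree X Y C closed agree k w Cp
  ... | true  | r≡ rewrite sym r≡ = agree q (reach-closed X C closed k r Cp)
  ... | false | r≡ rewrite sym r≡ = refl

componentRep : {n : ℕ} → Adjacency n → Fin n → Bool
componentRep {n} X p = hasNeighbour X p ∧ not (any (λ q → (toℕ q <ᵇ toℕ p) ∧ reachB X n q p) (allFin n))

has-neighbour : {n : ℕ} (X : Adjacency n) {p q : Fin n} → X p q ≡ true → hasNeighbour X p ≡ true
has-neighbour X {q = q} e = any-complete _ (∈-allFin q) e

Closed : {n : ℕ} → Adjacency n → List (Fin n) → Set
Closed X Ls = ∀ {a b} → a ∈ Ls → X a b ≡ true → b ∈ Ls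

componentRep-count : {n : ℕ} (X : Adjacency n) → (∀ a b → X a b ≡ X b a) →
                     (Ls : List (Fin n)) → AllPairs _≢_ Ls → Closed X Ls →
                     (∀ {p} → p ∈ Ls → hasNeighbour X p ≡ true) →
                     (∀ {p q} → p ∈ Ls → q ∈ Ls → reachB X n q p ≡ true) →
                     {x : Fin n} → x ∈ Ls → sumMap (b2n ∘ componentRep X) Ls ≡ 1
componentRep-count {n} X X-sym Ls Ls! closed nbr conn x∈Ls =
  trans (sumMap-cong (All.tabulate λ p∈ → cong b2n (rep⇔min p∈)))
        (count-minimum toℕ Ls (AllPairs.map (λ p≢q → p≢q ∘ Fin.toℕ-injective) Ls!) x∈Ls)
  where
  rep⇔min : ∀ {p} → p ∈ Ls → componentRep X p ≡ all (λ q → toℕ p ≤ᵇ toℕ q) Ls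
  rep⇔min {p} p∈ rewrite nbr p∈ = true-ext minimal no-smaller
    where
    minimal : not (any (λ q → (toℕ q <ᵇ toℕ p) ∧ reachB X n q p) (allFin n)) ≡ true →
              all (λ q → toℕ p ≤ᵇ toℕ q) Ls ≡ true
    minimal h = all-complete _ Ls λ {q} q∈ → ≤ᵇ-complete {toℕ p} {toℕ q} (≮⇒≥ λ q<p →
      true≢false (trans (sym (any-complete _ (∈-allFin q) (∧-intro (<ᵇ-complete {toℕ q} {toℕ p} q<p) (conn p∈ q∈))))
                        (not-injective h)))
    no-smaller : all (λ q → toℕ p ≤ᵇ toℕ q) Ls ≡ true →
                 not (any (λ q → (toℕ q <ᵇ toℕ p) ∧ reachB X n q p) (allFin n)) ≡ true
    no-smaller h = cong not (¬-not λ e → let (q , _ , qe) = any-sound _ (allFin n) e in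
      let (q<p , q⇝p) = ∧-true qe in
      <⇒≱ (<ᵇ-sound (toℕ q) (toℕ p) q<p) (≤ᵇ-sound (toℕ p) (toℕ q) (all-sound _ h (source-in q⇝p))))
      where
      source-in : ∀ {q} → reachB X n q p ≡ true → q ∈ Ls
      source-in {q} q⇝p with q ∈? Ls
      ... | yes q∈ = q∈
      ... | no  q∉ = ⊥-elim (reach-closed X (_∉ Ls) (λ a∉ e b∈ → a∉ (closed b∈ (trans (X-sym _ _) e))) n q⇝p q∉ p∈)


-- Face orbits

IsDart : {n : ℕ} → Adjacency n → Dart n → Set
IsDart X (p , q) = X p q ≡ true

≢-fst : {A B : Set} {a c : A} {b d : B} → a ≢ c → (a , b) ≢ (c , d)
≢-fst a≢c = a≢c ∘ ,-injectiveˡ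

≢-snd : {A B : Set} {a c : A} {b d : B} → b ≢ d → (a , b) ≢ (c , d)
≢-snd b≢d = b≢d ∘ ,-injectiveʳ

iter-+ : {A : Set} (f : A → A) (k i : ℕ) (d : A) → iter f (k + i) d ≡ iter f k (iter f i d)
iter-+ f zero    i d = refl
iter-+ f (suc k) i d = cong f (iter-+ f k i d)

iter-cong : {A : Set} {f g : A → A} → (∀ a → f a ≡ g a) → ∀ k a → iter f k a ≡ iter g k a
iter-cong f≗g zero    a = refl
iter-cong {g = g} f≗g (suc k) a = trans (f≗g _) (cong g (iter-cong f≗g k a))

dartKey-injective : {n : ℕ} {d e : Dart n} → dartKey d ≡ dartKey e → d ≡ e
dartKey-injective {n} {a , b} {c , d} key≡ with Fin.combine-injective a b c d (Fin.toℕ-injective combine≡)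
  where
  toℕ-combine : ∀ (i j : Fin n) → toℕ (combine i j) ≡ dartKey (i , j)
  toℕ-combine i j = trans (Fin.toℕ-combine i j) (cong (_+ toℕ j) (*-comm n (toℕ i)))
  combine≡ : toℕ (combine a b) ≡ toℕ (combine c d)
  combine≡ = trans (toℕ-combine a b) (trans key≡ (sym (toℕ-combine c d)))
... | refl , refl = refl

module _ {n : ℕ} (X : Adjacency n) (r : Fin n → Fin n → Fin n)
         (step-dart : ∀ {d} → IsDart X d → IsDart X (faceStep r d)) where

  module _ (ds : ℕ → Dart n) (L : ℕ) (0<L : 0 < L)
           (ds-step : ∀ {i} → i < L → faceStep r (ds i) ≡ ds (suc i)) (ds-period : ds L ≡ ds 0) where

    private
      step : Dart n → Dart n
      step = faceStep r

      cyc : List (Dart n)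
      cyc = applyUpTo ds L

      walk : ∀ k {i} → k + i ≤ L → iter step k (ds i) ≡ ds (k + i)
      walk zero    _     = refl
      walk (suc k) k+i<L = trans (cong step (walk k (<⇒≤ k+i<L))) (ds-step k+i<L)

      walk-from-0 : ∀ {j} → j ≤ L → iter step j (ds 0) ≡ ds j
      walk-from-0 {j} j≤L = trans (walk j (subst (_≤ L) (sym (+-identityʳ j)) j≤L)) (cong ds (+-identityʳ j))

      darts : IsDart X (ds 0) → ∀ {d} → d ∈ cyc → IsDart X d
      darts ds-dart d∈ with ∈-applyUpTo⁻ ds d∈
      ... | i , i<L , refl = subst (IsDart X) (walk-from-0 (<⇒≤ i<L)) (iterate-dart i)
        where
        iterate-dart : ∀ k → IsDart X (iter step k (ds 0))
        iterate-dart zero    = ds-dart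
        iterate-dart (suc k) = step-dart (iterate-dart k)

      step-closed : ∀ {d} → d ∈ cyc → step d ∈ cyc
      step-closed d∈ with ∈-applyUpTo⁻ ds d∈
      ... | i , i<L , refl with m≤n⇒m<n∨m≡n i<L
      ...   | inj₁ 1+i<L = subst (_∈ cyc) (sym (ds-step i<L)) (∈-applyUpTo⁺ ds 1+i<L)
      ...   | inj₂ 1+i≡L = subst (_∈ cyc) (sym (trans (ds-step i<L) (trans (cong ds 1+i≡L) ds-period)))
                             (∈-applyUpTo⁺ ds 0<L)

      iterates : ∀ k {d} → d ∈ cyc → iter step k d ∈ cyc
      iterates zero    d∈ = d∈
      iterates (suc k) d∈ = step-closed (iterates k d∈)

      reaches : ∀ {d e} → d ∈ cyc → e ∈ cyc → ∃ λ k → k < L × iter step k d ≡ e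
      reaches d∈ e∈ with ∈-applyUpTo⁻ ds d∈ | ∈-applyUpTo⁻ ds e∈
      ... | i , i<L , refl | j , j<L , refl with i ≤? j
      ...   | yes i≤j = j ∸ i , ≤-<-trans (m∸n≤m j i) j<L ,
                        trans (walk (j ∸ i) (subst (_≤ L) (sym (m∸n+n≡m i≤j)) (<⇒≤ j<L))) (cong ds (m∸n+n≡m i≤j))
      ...   | no  i≰j = j + (L ∸ i) , around< , around≡
        where
        L∸i+i≡L : L ∸ i + i ≡ L
        L∸i+i≡L = m∸n+n≡m (<⇒≤ i<L)
        around< : j + (L ∸ i) < L
        around< = subst (j + (L ∸ i) <_) (m+[n∸m]≡n (<⇒≤ i<L)) (+-monoˡ-< (L ∸ i) (≰⇒> i≰j))
        around≡ : iter step (j + (L ∸ i)) (ds i) ≡ ds j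
        around≡ = begin
          iter step (j + (L ∸ i)) (ds i)         ≡⟨ iter-+ step j (L ∸ i) (ds i) ⟩
          iter step j (iter step (L ∸ i) (ds i)) ≡⟨ cong (iter step j) (walk (L ∸ i) (≤-reflexive L∸i+i≡L)) ⟩
          iter step j (ds (L ∸ i + i))           ≡⟨ cong (iter step j) (trans (cong ds L∸i+i≡L) ds-period) ⟩
          iter step j (ds 0)                     ≡⟨ walk-from-0 (<⇒≤ j<L) ⟩
          ds j                                   ∎
          where open ≡-Reasoning

      -- isFaceRep only inspects the first n * n darts of an orbit, hence the bound on L.
      rep⇔min : L ≤ n * n → IsDart X (ds 0) → ∀ {d} → d ∈ cyc →
                isFaceRep X r d ≡ all (λ e → dartKey d ≤ᵇ dartKey e) cyc
      rep⇔min L≤n*n ds-dart {d} d∈ rewrite darts ds-dart d∈ = true-ext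
        (λ h → all-complete _ cyc λ e∈ → let (k , k<L , d⇝e) = reaches d∈ e∈ in
          subst (λ e → (dartKey d ≤ᵇ dartKey e) ≡ true) d⇝e (all-sound _ h (∈-upTo⁺ (<-≤-trans k<L L≤n*n))))
        (λ h → all-complete _ (upTo (n * n)) λ {k} _ → all-sound _ h (iterates k d∈))

    faceRep-cycle : L ≤ n * n → IsDart X (ds 0) → AllPairs _≢_ (applyUpTo ds L) →
                    sumMap (b2n ∘ isFaceRep X r) (applyUpTo ds L) ≡ 1
    faceRep-cycle L≤n*n ds-dart ds! =
      trans (sumMap-cong (All.tabulate λ d∈ → cong b2n (rep⇔min L≤n*n ds-dart d∈)))
            (count-minimum dartKey cyc (AllPairs.map (λ d≢e → d≢e ∘ dartKey-injective) ds!) (∈-applyUpTo⁺ ds 0<L))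

  triangle-face : {a b c : Fin n} → 3 ≤ n * n → X a b ≡ true →
                  r b a ≡ c → r c b ≡ a → r a c ≡ b → a ≢ b → b ≢ c → a ≢ c →
                  sumMap (b2n ∘ isFaceRep X r) ((a , b) ∷ (b , c) ∷ (c , a) ∷ []) ≡ 1
  triangle-face {a} {b} {c} 3≤n*n ab rba rcb rac a≢b b≢c a≢c =
    faceRep-cycle ds 3 (s≤s z≤n) step refl 3≤n*n ab
      ((≢-fst a≢b ∷ ≢-fst a≢c ∷ []) ∷ (≢-fst b≢c ∷ []) ∷ [] ∷ [])
    where
    ds : ℕ → Dart n
    ds 0 = a , b
    ds 1 = b , c
    ds 2 = c , a
    ds _ = a , b
    step : ∀ {i} → i < 3 → faceStep r (ds i) ≡ ds (suc i)
    step {0} _ = cong (b ,_) rba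
    step {1} _ = cong (c ,_) rcb
    step {2} _ = cong (a ,_) rac
    step {suc (suc (suc _))} (s≤s (s≤s (s≤s ())))

faceRep-row : {n : ℕ} (X : Adjacency n) (r : Fin n → Fin n → Fin n) (p : Fin n) (Ls : List (Fin n)) →
              AllPairs _≢_ Ls → (∀ {q} → X p q ≡ true → q ∈ Ls) →
              countFin n (λ q → isFaceRep X r (p , q)) ≡ sumMap (λ q → b2n (isFaceRep X r (p , q))) Ls
faceRep-row {n} X r p Ls Ls! nbrs = countFin-support n _ Ls Ls! (λ q rep → nbrs (proj₁ (∧-true rep)))

edgeCount-insert : {n : ℕ} (X Y : Adjacency n) {a b : Fin n} → toℕ a < toℕ b → X a b ≡ false →
                   (∀ p q → Y p q ≡ (X p q ∨ ((p == a ∧ q == b) ∨ (p == b ∧ q == a)))) →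
                   edgeCount Y ≡ edgeCount X + 1
edgeCount-insert {n} X Y {a} {b} a<b Xab Y≡ = +-cancelʳ-≡ (row X a) _ _ (begin
  edgeCount Y + row X a       ≡⟨ sumFin-update n (row X) (row Y) a rows-off-a ⟨
  edgeCount X + row Y a       ≡⟨ cong (edgeCount X +_) row-a ⟩
  edgeCount X + (row X a + 1) ≡⟨ shuffle (edgeCount X) (row X a) ⟩
  edgeCount X + 1 + row X a   ∎)
  where
  open ≡-Reasoning
  shuffle : ∀ x y → x + (y + 1) ≡ x + 1 + y
  shuffle = solve-∀
  entry : Adjacency n → Fin n → Fin n → ℕ
  entry Z p q = b2n ((toℕ p <ᵇ toℕ q) ∧ Z p q)
  row : Adjacency n → Fin n → ℕ
  row Z p = sumFin n (entry Z p)
  b≮a : (toℕ b <ᵇ toℕ a) ≡ false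
  b≮a = ¬-not λ b<a → <-asym a<b (<ᵇ-sound (toℕ b) (toℕ a) b<a)
  entry-off-a : ∀ p q → p ≢ a → entry X p q ≡ entry Y p q
  entry-off-a p q p≢a rewrite Y≡ p q | ==-≢ p≢a with p ≟ b | q ≟ a
  ... | yes refl | yes refl rewrite b≮a = refl
  ... | yes _    | no _     rewrite ∨-identityʳ (X p q) = refl
  ... | no _     | _        rewrite ∨-identityʳ (X p q) = refl
  rows-off-a : ∀ p → p ≢ a → row X p ≡ row Y p
  rows-off-a p p≢a = sumFin-cong n (λ q → entry-off-a p q p≢a)
  entry-a-off-b : ∀ q → q ≢ b → entry X a q ≡ entry Y a q
  entry-a-off-b q q≢b rewrite Y≡ a q | ==-refl a | ==-≢ q≢b with a ≟ b
  ... | yes a≡b = ⊥-elim (<-irrefl (cong toℕ a≡b) a<b)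
  ... | no _    rewrite ∨-identityʳ (X a q) = refl
  entry-a-b : entry Y a b ≡ entry X a b + 1
  entry-a-b rewrite Y≡ a b | Xab | ==-refl a | ==-refl b | <ᵇ-complete a<b = refl
  row-a : row Y a ≡ row X a + 1
  row-a = +-cancelʳ-≡ (entry X a b) _ _ (begin
    row Y a + entry X a b       ≡⟨ sumFin-update n (entry X a) (entry Y a) b entry-a-off-b ⟨
    row X a + entry Y a b       ≡⟨ cong (row X a +_) entry-a-b ⟩
    row X a + (entry X a b + 1) ≡⟨ shuffle (row X a) (entry X a b) ⟩
    row X a + 1 + entry X a b   ∎)

-- Isolated triangles and diamonds in a plane graph

iter-swap : {A : Set} (f : A → A) {b c : A} → f b ≡ c → f c ≡ b → ∀ k → iter f k b ≡ b ⊎ iter f k b ≡ c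
iter-swap f fb fc zero = inj₁ refl
iter-swap f fb fc (suc k) with iter-swap f fb fc k
... | inj₁ e = inj₂ (trans (cong f e) fb)
... | inj₂ e = inj₁ (trans (cong f e) fc)

∉-∷⁴ : {n : ℕ} {p a b c d : Fin n} → p ∉ (a ∷ b ∷ c ∷ d ∷ []) → p ≢ a × p ≢ b × p ≢ c × p ≢ d
∉-∷⁴ p∉ = p∉ ∘ here , p∉ ∘ there ∘ here , p∉ ∘ there ∘ there ∘ here , p∉ ∘ there ∘ there ∘ there ∘ here

C3∪C4-witness : {n : ℕ} (X : Adjacency n) {t₀ t₁ t₂ s₀ s₁ s₂ s₃ : Fin n} →
                X t₀ t₁ ≡ true → X t₁ t₂ ≡ true → X t₂ t₀ ≡ true →
                X s₀ s₁ ≡ true → X s₁ s₂ ≡ true → X s₂ s₃ ≡ true → X s₃ s₀ ≡ true →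
                Unique (t₀ ∷ t₁ ∷ t₂ ∷ s₀ ∷ s₁ ∷ s₂ ∷ s₃ ∷ []) → ContainsC3∪C4 X
C3∪C4-witness X t₀₁ t₁₂ t₂₀ s₀₁ s₁₂ s₂₃ s₃₀ distinct =
  lookup (_ ∷ _ ∷ _ ∷ _ ∷ _ ∷ _ ∷ _ ∷ []) , (λ {i} {j} → lookup-injective distinct i j) ,
  t₀₁ , t₁₂ , t₂₀ , s₀₁ , s₁₂ , s₂₃ , s₃₀

member-third : {n : ℕ} {p a b c : Fin n} → p ∈ (a ∷ b ∷ c ∷ []) → p ≢ a → p ≢ b → p ≡ c
member-third (here p≡a)                p≢a _   = ⊥-elim (p≢a p≡a)
member-third (there (here p≡b))        _   p≢b = ⊥-elim (p≢b p≡b)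
member-third (there (there (here p≡c))) _   _   = p≡c

ShareTwo : {n : ℕ} → List (Fin n) → List (Fin n) → Set
ShareTwo Es Fs = ∃₂ λ p q → p ≢ q × p ∈ Es × p ∈ Fs × q ∈ Es × q ∈ Fs

OnlyCommon : {n : ℕ} → List (Fin n) → List (Fin n) → Fin n → Set
OnlyCommon Es Fs z = ∀ {q} → q ∈ Es → q ∈ Fs → q ≡ z

share-two-or-only : {n : ℕ} (Es Fs : List (Fin n)) {z : Fin n} → z ∈ Es → z ∈ Fs →
                    ShareTwo Es Fs ⊎ OnlyCommon Es Fs z
share-two-or-only Es Fs {z} z∈E z∈F with any? (λ q → q ∈? Fs ×-dec ¬? (q ≟ z)) Es
... | yes second = let (q , q∈E , q∈F , q≢z) = find second in
                   inj₁ (z , q , q≢z ∘ sym , z∈E , z∈F , q∈E , q∈F)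
... | no  none   = inj₂ only
  where
  only : OnlyCommon Es Fs z
  only {q} q∈E q∈F with q ≟ z
  ... | yes q≡z = q≡z
  ... | no  q≢z = ⊥-elim (none (lose q∈E (q∈F , q≢z)))

only-common-∉ : {n : ℕ} {Es Fs : List (Fin n)} {z p : Fin n} → OnlyCommon Es Fs z → p ∈ Es → z ≢ p → p ∉ Fs
only-common-∉ only p∈E z≢p p∈F = z≢p (sym (only p∈E p∈F))

module Plane {n : ℕ} (G : PlaneGraph n) where

  A : Adjacency n
  A = adj G

  edge-flip : {p q : Fin n} → A p q ≡ true → A q p ≡ true
  edge-flip {p} {q} e = trans (adj-sym G q p) e

  edge-≢ : {p q : Fin n} → A p q ≡ true → p ≢ q
  edge-≢ {p} e refl = true≢false (trans (sym e) (adj-irrefl G p))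

  rot-edge : {p q s : Fin n} → A p q ≡ true → rot G p q ≡ s → A p s ≡ true
  rot-edge {p} {q} e refl = rot-adj G p q e

  two-neighbours : {p q₁ q₂ s : Fin n} → rot G p q₁ ≡ q₂ → rot G p q₂ ≡ q₁ →
                   A p q₁ ≡ true → A p s ≡ true → s ≡ q₁ ⊎ s ≡ q₂
  two-neighbours {p} {q₁} {s = s} r₁ r₂ e₁ eₛ with rot-cyc G p q₁ s e₁ eₛ
  ... | k , q₁⇝s with iter-swap (rot G p) r₁ r₂ k
  ...   | inj₁ e = inj₁ (trans (sym q₁⇝s) e)
  ...   | inj₂ e = inj₂ (trans (sym q₁⇝s) e)

  triangle-square : {t₀ t₁ t₂ s₀ s₁ s₂ s₃ : Fin n} →
                    A t₀ t₁ ≡ true → A t₁ t₂ ≡ true → A t₂ t₀ ≡ true →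
                    A s₀ s₁ ≡ true → A s₁ s₂ ≡ true → A s₂ s₃ ≡ true → A s₃ s₀ ≡ true →
                    s₀ ≢ s₂ → s₁ ≢ s₃ →
                    t₀ ∉ (s₀ ∷ s₁ ∷ s₂ ∷ s₃ ∷ []) → t₁ ∉ (s₀ ∷ s₁ ∷ s₂ ∷ s₃ ∷ []) →
                    t₂ ∉ (s₀ ∷ s₁ ∷ s₂ ∷ s₃ ∷ []) → ContainsC3∪C4 A
  triangle-square t₀₁ t₁₂ t₂₀ s₀₁ s₁₂ s₂₃ s₃₀ s₀≢s₂ s₁≢s₃ t₀∉ t₁∉ t₂∉ =
    let (t₀≢s₀ , t₀≢s₁ , t₀≢s₂ , t₀≢s₃) = ∉-∷⁴ t₀∉
        (t₁≢s₀ , t₁≢s₁ , t₁≢s₂ , t₁≢s₃) = ∉-∷⁴ t₁∉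
        (t₂≢s₀ , t₂≢s₁ , t₂≢s₂ , t₂≢s₃) = ∉-∷⁴ t₂∉
    in C3∪C4-witness A t₀₁ t₁₂ t₂₀ s₀₁ s₁₂ s₂₃ s₃₀
         ((edge-≢ t₀₁ ∷ edge-≢ t₂₀ ∘ sym ∷ t₀≢s₀ ∷ t₀≢s₁ ∷ t₀≢s₂ ∷ t₀≢s₃ ∷ []) ∷
          (edge-≢ t₁₂ ∷ t₁≢s₀ ∷ t₁≢s₁ ∷ t₁≢s₂ ∷ t₁≢s₃ ∷ []) ∷
          (t₂≢s₀ ∷ t₂≢s₁ ∷ t₂≢s₂ ∷ t₂≢s₃ ∷ []) ∷
          (edge-≢ s₀₁ ∷ s₀≢s₂ ∷ edge-≢ s₃₀ ∘ sym ∷ []) ∷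
          (edge-≢ s₁₂ ∷ s₁≢s₃ ∷ []) ∷
          (edge-≢ s₂₃ ∷ []) ∷ [] ∷ [])

  record IsolatedTriangle (a b c : Fin n) : Set where
    field
      ab     : A a b ≡ true
      rot-ab : rot G a b ≡ c
      rot-ac : rot G a c ≡ b
      rot-ba : rot G b a ≡ c
      rot-bc : rot G b c ≡ a
      rot-ca : rot G c a ≡ b
      rot-cb : rot G c b ≡ a

    ac : A a c ≡ true
    ac = rot-edge ab rot-ab
    ba : A b a ≡ true
    ba = edge-flip ab
    bc : A b c ≡ true
    bc = rot-edge ba rot-ba
    ca : A c a ≡ true
    ca = edge-flip ac
    cb : A c b ≡ true
    cb = edge-flip bc

    vertices : List (Fin n)
    vertices = a ∷ b ∷ c ∷ []

    neighbours-a : ∀ {q} → A a q ≡ true → q ≡ b ⊎ q ≡ c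
    neighbours-a = two-neighbours rot-ab rot-ac ab
    neighbours-b : ∀ {q} → A b q ≡ true → q ≡ a ⊎ q ≡ c
    neighbours-b = two-neighbours rot-ba rot-bc ba
    neighbours-c : ∀ {q} → A c q ≡ true → q ≡ a ⊎ q ≡ b
    neighbours-c = two-neighbours rot-ca rot-cb ca

    some-neighbour : ∀ {p} → p ∈ vertices → ∃ λ q → A p q ≡ true
    some-neighbour (here refl)                = b , ab
    some-neighbour (there (here refl))        = a , ba
    some-neighbour (there (there (here refl))) = a , ca

    closed : Closed A vertices
    closed (here refl) e with neighbours-a e
    ... | inj₁ refl = there (here refl)
    ... | inj₂ refl = there (there (here refl))
    closed (there (here refl)) e with neighbours-b e
    ... | inj₁ refl = here refl
    ... | inj₂ refl = there (there (here refl))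
    closed (there (there (here refl))) e with neighbours-c e
    ... | inj₁ refl = here refl
    ... | inj₂ refl = there (here refl)

    equal-or-adjacent : ∀ {p q} → p ∈ vertices → q ∈ vertices → p ≡ q ⊎ A p q ≡ true
    equal-or-adjacent (here refl)                (here refl)                = inj₁ refl
    equal-or-adjacent (here refl)                (there (here refl))        = inj₂ ab
    equal-or-adjacent (here refl)                (there (there (here refl))) = inj₂ ac
    equal-or-adjacent (there (here refl))        (here refl)                = inj₂ ba
    equal-or-adjacent (there (here refl))        (there (here refl))        = inj₁ refl
    equal-or-adjacent (there (here refl))        (there (there (here refl))) = inj₂ bc
    equal-or-adjacent (there (there (here refl))) (here refl)                = inj₂ ca
    equal-or-adjacent (there (there (here refl))) (there (here refl))        = inj₂ cb
    equal-or-adjacent (there (there (here refl))) (there (there (here refl))) = inj₁ refl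

  isolated-triangle-component : ∀ {a b c} → IsolatedTriangle a b c → sumMap (b2n ∘ componentRep A) (a ∷ b ∷ c ∷ []) ≡ 1
  isolated-triangle-component {a} T =
    componentRep-count A (adj-sym G) T.vertices distinct T.closed neighbour connected (here refl)
    where
    module T = IsolatedTriangle T
    distinct : AllPairs _≢_ T.vertices
    distinct = (edge-≢ T.ab ∷ edge-≢ T.ac ∷ []) ∷ (edge-≢ T.bc ∷ []) ∷ [] ∷ []
    neighbour : ∀ {p} → p ∈ T.vertices → hasNeighbour A p ≡ true
    neighbour p∈ = has-neighbour A (proj₂ (T.some-neighbour p∈))
    connected : ∀ {p q} → p ∈ T.vertices → q ∈ T.vertices → reachB A n q p ≡ true
    connected p∈ q∈ with T.equal-or-adjacent q∈ p∈
    ... | inj₁ refl = reach-refl A n _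
    ... | inj₂ qp   = reach-≤ A (≤-trans (s≤s z≤n) (Fin.toℕ<n a)) (reach-edge A qp)

  record Diamond (u v a b : Fin n) : Set where
    field
      uv  : A u v ≡ true
      ua  : A u a ≡ true
      va  : A v a ≡ true
      ub  : A u b ≡ true
      vb  : A v b ≡ true
      a≢b : a ≢ b

    vertices : List (Fin n)
    vertices = u ∷ a ∷ v ∷ b ∷ []

    triangle-beside : ∀ {t₀ t₁ t₂} → A t₀ t₁ ≡ true → A t₁ t₂ ≡ true → A t₂ t₀ ≡ true →
                      t₀ ∉ vertices → t₁ ∉ vertices → t₂ ∉ vertices → ContainsC3∪C4 A
    triangle-beside t₀₁ t₁₂ t₂₀ =
      triangle-square t₀₁ t₁₂ t₂₀ ua (edge-flip va) vb (edge-flip ub) (edge-≢ uv) a≢b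

  module _ {u v a b x y c d : Fin n} (E : Diamond u v a b) (F : Diamond x y c d)
           (u≢x : u ≢ x) (u≢y : u ≢ y) (v≢x : v ≢ x) (v≢y : v ≢ y) where
    private
      module E = Diamond E
      module F = Diamond F

    -- The triangle u v t with t ∈ {a, b} ∖ {z} misses F.
    triangle-of-E-beside-F : ∀ {z} → z ∈ E.vertices → z ≢ u → z ≢ v → OnlyCommon E.vertices F.vertices z →
                             ContainsC3∪C4 A
    triangle-of-E-beside-F (here z≡u)                 z≢u _   _    = ⊥-elim (z≢u z≡u)
    triangle-of-E-beside-F (there (there (here z≡v))) _   z≢v _    = ⊥-elim (z≢v z≡v)
    triangle-of-E-beside-F (there (here refl))        z≢u z≢v only =
      F.triangle-beside E.uv E.vb (edge-flip E.ub)
        (only-common-∉ only (here refl) z≢u) (only-common-∉ only (there (there (here refl))) z≢v)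
        (only-common-∉ only (there (there (there (here refl)))) E.a≢b)
    triangle-of-E-beside-F (there (there (there (here refl)))) z≢u z≢v only =
      F.triangle-beside E.uv E.va (edge-flip E.ua)
        (only-common-∉ only (here refl) z≢u) (only-common-∉ only (there (there (here refl))) z≢v)
        (only-common-∉ only (there (here refl)) (E.a≢b ∘ sym))

    diamonds-share-two : ShareTwo E.vertices F.vertices ⊎ ContainsC3∪C4 A
    diamonds-share-two with x ∈? E.vertices | y ∈? E.vertices | c ∈? E.vertices
    ... | yes x∈E | _       | _       = map₂ (triangle-of-E-beside-F x∈E (u≢x ∘ sym) (v≢x ∘ sym))
                                             (share-two-or-only _ _ x∈E (here refl))
    ... | no _    | yes y∈E | _       = map₂ (triangle-of-E-beside-F y∈E (u≢y ∘ sym) (v≢y ∘ sym))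
                                             (share-two-or-only _ _ y∈E (there (there (here refl))))
    ... | no x∉E  | no y∉E  | no c∉E  = inj₂ (E.triangle-beside F.uv F.va (edge-flip F.ua) x∉E y∉E c∉E)
    ... | no x∉E  | no y∉E  | yes c∈E = map₂ triangle-xyd (share-two-or-only _ _ c∈E (there (here refl)))
      where
      triangle-xyd : OnlyCommon E.vertices F.vertices c → ContainsC3∪C4 A
      triangle-xyd only = E.triangle-beside F.uv F.vb (edge-flip F.ub) x∉E y∉E
                            λ d∈E → F.a≢b (sym (only d∈E (there (there (there (here refl))))))

  module _ {u v a x y : Fin n} (T : IsolatedTriangle u v a)
           (u≢x : u ≢ x) (u≢y : u ≢ y) (v≢x : v ≢ x) (v≢y : v ≢ y) where
    private
      module T = IsolatedTriangle T

    edge-outside-isolated : A x y ≡ true → x ∈ T.vertices → ⊥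
    edge-outside-isolated xy x∈T =
      edge-≢ xy (trans (member-third x∈T (u≢x ∘ sym) (v≢x ∘ sym))
                       (sym (member-third (T.closed x∈T xy) (u≢y ∘ sym) (v≢y ∘ sym))))

    isolated-triangle-beside-diamond : ∀ {c d} → Diamond x y c d → ContainsC3∪C4 A
    isolated-triangle-beside-diamond F =
      F.triangle-beside T.ab T.bc T.ca (outside (here refl)) (outside (there (here refl)))
        (outside (there (there (here refl))))
      where
      module F = Diamond F
      outside : ∀ {p} → p ∈ T.vertices → p ∉ F.vertices
      outside p∈T (here refl)                        = edge-outside-isolated F.uv p∈T
      outside p∈T (there (here refl))                = edge-outside-isolated F.uv (T.closed p∈T (edge-flip F.ua))
      outside p∈T (there (there (here refl)))        = edge-outside-isolated F.uv (T.closed p∈T (edge-flip F.uv))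
      outside p∈T (there (there (there (here refl)))) = edge-outside-isolated F.uv (T.closed p∈T (edge-flip F.ub))

    isolated-triangles-disjoint : ∀ {c} → IsolatedTriangle x y c → ∀ {p} → p ∈ T.vertices → p ∉ (x ∷ y ∷ c ∷ [])
    isolated-triangles-disjoint T′ {p} p∈T p∈T′ = edge-outside-isolated T′.ab x∈T
      where
      module T′ = IsolatedTriangle T′
      x∈T : x ∈ T.vertices
      x∈T with T′.equal-or-adjacent p∈T′ (here refl)
      ... | inj₁ refl = p∈T
      ... | inj₂ px   = T.closed p∈T px

-- Joining two isolated triangles by an edge

module _ {A : Set} (f : A → A) {a b c : A} (fa : f a ≡ b) (fb : f b ≡ c) (fc : f c ≡ a) where

  three-cycle-cube : ∀ {q} → q ∈ (a ∷ b ∷ c ∷ []) → f (f (f q)) ≡ q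
  three-cycle-cube (here refl)                = trans (cong (f ∘ f) fa) (trans (cong f fb) fc)
  three-cycle-cube (there (here refl))        = trans (cong (f ∘ f) fb) (trans (cong f fc) fa)
  three-cycle-cube (there (there (here refl))) = trans (cong (f ∘ f) fc) (trans (cong f fa) fb)

  three-cycle-injective : ∀ {q q′} → q ∈ (a ∷ b ∷ c ∷ []) → q′ ∈ (a ∷ b ∷ c ∷ []) → f q ≡ f q′ → q ≡ q′
  three-cycle-injective q∈ q′∈ e = trans (sym (three-cycle-cube q∈)) (trans (cong (f ∘ f) e) (three-cycle-cube q′∈))

  three-cycle-orbit : ∀ {q q′} → q ∈ (a ∷ b ∷ c ∷ []) → q′ ∈ (a ∷ b ∷ c ∷ []) → ∃ λ k → iter f k q ≡ q′
  three-cycle-orbit {q} {q′} q∈ q′∈ with to-a q∈ | from-a q′∈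
    where
    to-a : ∀ {q} → q ∈ (a ∷ b ∷ c ∷ []) → ∃ λ k → iter f k q ≡ a
    to-a (here refl)                = 0 , refl
    to-a (there (here refl))        = 2 , trans (cong f fb) fc
    to-a (there (there (here refl))) = 1 , fc
    from-a : ∀ {q′} → q′ ∈ (a ∷ b ∷ c ∷ []) → ∃ λ k → iter f k a ≡ q′
    from-a (here refl)                = 0 , refl
    from-a (there (here refl))        = 1 , fa
    from-a (there (there (here refl))) = 2 , trans (cong f fa) fb
  ... | k , q⇝a | k′ , a⇝q′ = k′ + k , trans (iter-+ f k′ k q) (trans (cong (iter f k′) q⇝a) a⇝q′)

euler-arith : ∀ {V F F′ E E′ C C′ : ℕ} → V + F ≡ E + 2 * C → F + 3 ≡ F′ + 4 → C + 1 ≡ C′ + 2 → E′ ≡ E + 1 →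
              V + F′ ≡ E′ + 2 * C′
euler-arith {V} {F} {F′} {E} {E′} {C} {C′} euler-old faces comps refl = +-cancelʳ-≡ 1 _ _ (begin
  V + F′ + 1          ≡⟨ +-assoc V F′ 1 ⟩
  V + (F′ + 1)        ≡⟨ cong (V +_) F′+1≡F ⟩
  V + F               ≡⟨ euler-old ⟩
  E + 2 * C           ≡⟨ cong (λ c → E + 2 * c) C≡C′+1 ⟩
  E + 2 * (C′ + 1)    ≡⟨ shuffle E C′ ⟩
  E + 1 + 2 * C′ + 1  ∎)
  where
  open ≡-Reasoning
  F′+1≡F : F′ + 1 ≡ F
  F′+1≡F = +-cancelʳ-≡ 3 _ _ (trans (+-assoc F′ 1 3) (sym faces))
  C≡C′+1 : C ≡ C′ + 1
  C≡C′+1 = +-cancelʳ-≡ 1 _ _ (trans comps (sym (+-assoc C′ 1 1)))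
  shuffle : ∀ e c → e + 2 * (c + 1) ≡ e + 1 + 2 * c + 1
  shuffle = solve-∀

module JoinIsolatedTriangles {n : ℕ} (G : PlaneGraph n) {u v w x y z : Fin n}
  (T₁ : Plane.IsolatedTriangle G u v w) (T₂ : Plane.IsolatedTriangle G x y z)
  (disjoint : ∀ {p} → p ∈ (u ∷ v ∷ w ∷ []) → p ∉ (x ∷ y ∷ z ∷ [])) where

  open Plane G
  private
    module T₁ = IsolatedTriangle T₁
    module T₂ = IsolatedTriangle T₂

  u≢v : u ≢ v
  u≢v = edge-≢ T₁.ab
  v≢w : v ≢ w
  v≢w = edge-≢ T₁.bc
  u≢w : u ≢ w
  u≢w = edge-≢ T₁.ac
  x≢y : x ≢ y
  x≢y = edge-≢ T₂.ab
  y≢z : y ≢ z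
  y≢z = edge-≢ T₂.bc
  x≢z : x ≢ z
  x≢z = edge-≢ T₂.ac
  u≢x : u ≢ x
  u≢x = disjoint (here refl) ∘ here
  u≢y : u ≢ y
  u≢y = disjoint (here refl) ∘ there ∘ here
  u≢z : u ≢ z
  u≢z = disjoint (here refl) ∘ there ∘ there ∘ here
  v≢x : v ≢ x
  v≢x = disjoint (there (here refl)) ∘ here
  v≢y : v ≢ y
  v≢y = disjoint (there (here refl)) ∘ there ∘ here
  v≢z : v ≢ z
  v≢z = disjoint (there (here refl)) ∘ there ∘ there ∘ here
  w≢x : w ≢ x
  w≢x = disjoint (there (there (here refl))) ∘ here
  w≢y : w ≢ y
  w≢y = disjoint (there (there (here refl))) ∘ there ∘ here
  w≢z : w ≢ z
  w≢z = disjoint (there (there (here refl))) ∘ there ∘ there ∘ here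

  Ts : List (Fin n)
  Ts = u ∷ v ∷ w ∷ x ∷ y ∷ z ∷ []

  Ts-distinct : AllPairs _≢_ Ts
  Ts-distinct = (u≢v ∷ u≢w ∷ u≢x ∷ u≢y ∷ u≢z ∷ []) ∷ (v≢w ∷ v≢x ∷ v≢y ∷ v≢z ∷ []) ∷
                (w≢x ∷ w≢y ∷ w≢z ∷ []) ∷ (x≢y ∷ x≢z ∷ []) ∷ (y≢z ∷ []) ∷ [] ∷ []

  Ts-split : ∀ {p} → p ∈ Ts → p ∈ T₁.vertices ⊎ p ∈ T₂.vertices
  Ts-split (here e)                 = inj₁ (here e)
  Ts-split (there (here e))         = inj₁ (there (here e))
  Ts-split (there (there (here e))) = inj₁ (there (there (here e)))
  Ts-split (there (there (there m))) = inj₂ m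

  T₁⊆Ts : ∀ {p} → p ∈ T₁.vertices → p ∈ Ts
  T₁⊆Ts (here e)                 = here e
  T₁⊆Ts (there (here e))         = there (here e)
  T₁⊆Ts (there (there (here e))) = there (there (here e))

  T₂⊆Ts : ∀ {p} → p ∈ T₂.vertices → p ∈ Ts
  T₂⊆Ts = there ∘ there ∘ there

  Ts-closed : Closed A Ts
  Ts-closed p∈ e with Ts-split p∈
  ... | inj₁ p∈T₁ = T₁⊆Ts (T₁.closed p∈T₁ e)
  ... | inj₂ p∈T₂ = T₂⊆Ts (T₂.closed p∈T₂ e)

  outside-Ts : ∀ {p q} → p ∉ Ts → A p q ≡ true → q ∉ Ts
  outside-Ts p∉ e q∈ = p∉ (Ts-closed q∈ (edge-flip e))

  -- H: the edge ux added, x inserted after v in the rotation at u and u after y at x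
  adjH : Adjacency n
  adjH p q = A p q ∨ ((p == u ∧ q == x) ∨ (p == x ∧ q == u))

  rotU : Fin n → Fin n
  rotU q = if q == v then x else (if q == x then w else rot G u q)

  rotX : Fin n → Fin n
  rotX q = if q == y then u else (if q == u then z else rot G x q)

  rotH : Fin n → Fin n → Fin n
  rotH p q = if p == u then rotU q else (if p == x then rotX q else rot G p q)

  rotH-u : ∀ q → rotH u q ≡ rotU q
  rotH-u q rewrite ==-refl u = refl

  rotH-x : ∀ q → rotH x q ≡ rotX q
  rotH-x q rewrite ==-≢ (u≢x ∘ sym) | ==-refl x = refl

  rotH-other : ∀ {p} q → p ≢ u → p ≢ x → rotH p q ≡ rot G p q
  rotH-other q p≢u p≢x rewrite ==-≢ p≢u | ==-≢ p≢x = refl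

  rotU-v : rotU v ≡ x
  rotU-v rewrite ==-refl v = refl
  rotU-x : rotU x ≡ w
  rotU-x rewrite ==-≢ (v≢x ∘ sym) | ==-refl x = refl
  rotU-w : rotU w ≡ v
  rotU-w rewrite ==-≢ (v≢w ∘ sym) | ==-≢ w≢x = T₁.rot-ac

  rotX-y : rotX y ≡ u
  rotX-y rewrite ==-refl y = refl
  rotX-u : rotX u ≡ z
  rotX-u rewrite ==-≢ u≢y | ==-refl u = refl
  rotX-z : rotX z ≡ y
  rotX-z rewrite ==-≢ (y≢z ∘ sym) | ==-≢ (u≢z ∘ sym) = T₂.rot-ac

  adjH-old : ∀ {p q} → A p q ≡ true → adjH p q ≡ true
  adjH-old = ∨-introˡ

  adjH-ux : adjH u x ≡ true
  adjH-ux rewrite ==-refl u | ==-refl x = ∨-zeroʳ (A u x)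

  adjH-xu : adjH x u ≡ true
  adjH-xu rewrite ==-refl u | ==-refl x | ==-≢ (u≢x ∘ sym) = ∨-zeroʳ (A x u)

  adjH-other : ∀ {p} q → p ≢ u → p ≢ x → adjH p q ≡ A p q
  adjH-other {p} q p≢u p≢x rewrite ==-≢ p≢u | ==-≢ p≢x = ∨-identityʳ (A p q)

  adjH-split : ∀ {p q} → adjH p q ≡ true → A p q ≡ true ⊎ (p ≡ u × q ≡ x) ⊎ (p ≡ x × q ≡ u)
  adjH-split {p} {q} e with ∨-true {A p q} e
  ... | inj₁ old = inj₁ old
  ... | inj₂ new with ∨-true {p == u ∧ q == x} new
  ...   | inj₁ ux = let (p=u , q=x) = ∧-true ux in inj₂ (inj₁ (==⇒≡ p=u , ==⇒≡ q=x))
  ...   | inj₂ xu = let (p=x , q=u) = ∧-true xu in inj₂ (inj₂ (==⇒≡ p=x , ==⇒≡ q=u))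

  adjH-sym : ∀ p q → adjH p q ≡ adjH q p
  adjH-sym p q = cong₂ _∨_ (adj-sym G p q)
    (trans (∨-comm (p == u ∧ q == x) (p == x ∧ q == u))
           (cong₂ _∨_ (∧-comm (p == x) (q == u)) (∧-comm (p == u) (q == x))))

  adjH-flip : ∀ {p q} → adjH p q ≡ true → adjH q p ≡ true
  adjH-flip {p} {q} e = trans (adjH-sym q p) e

  adjH-irrefl : ∀ p → adjH p p ≡ false
  adjH-irrefl p rewrite adj-irrefl G p with p ≟ u | p ≟ x
  ... | yes refl | yes u≡x = ⊥-elim (u≢x u≡x)
  ... | yes refl | no _    = refl
  ... | no _     | yes _   = refl
  ... | no _     | no _    = refl

  A-ux : A u x ≡ false
  A-ux = ¬-not λ e → disjoint (T₁.closed (here refl) e) (here refl)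

  neighbours-u : ∀ {q} → adjH u q ≡ true → q ∈ (v ∷ x ∷ w ∷ [])
  neighbours-u e with adjH-split e
  ... | inj₂ (inj₁ (_ , refl)) = there (here refl)
  ... | inj₂ (inj₂ (u≡x , _))  = ⊥-elim (u≢x u≡x)
  ... | inj₁ old with T₁.neighbours-a old
  ...   | inj₁ refl = here refl
  ...   | inj₂ refl = there (there (here refl))

  neighbours-x : ∀ {q} → adjH x q ≡ true → q ∈ (y ∷ u ∷ z ∷ [])
  neighbours-x e with adjH-split e
  ... | inj₂ (inj₁ (x≡u , _))  = ⊥-elim (u≢x (sym x≡u))
  ... | inj₂ (inj₂ (_ , refl)) = there (here refl)
  ... | inj₁ old with T₂.neighbours-a old
  ...   | inj₁ refl = here refl
  ...   | inj₂ refl = there (there (here refl))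

  adjH-old-at : ∀ {p q} → p ≢ u → p ≢ x → adjH p q ≡ true → A p q ≡ true
  adjH-old-at {q = q} p≢u p≢x e = trans (sym (adjH-other q p≢u p≢x)) e

  two-∈ : {p a b : Fin n} → p ≡ a ⊎ p ≡ b → p ∈ (a ∷ b ∷ [])
  two-∈ (inj₁ p≡a) = here p≡a
  two-∈ (inj₂ p≡b) = there (here p≡b)

  neighbours-v : ∀ {q} → adjH v q ≡ true → q ∈ (u ∷ w ∷ [])
  neighbours-v = two-∈ ∘ T₁.neighbours-b ∘ adjH-old-at (u≢v ∘ sym) v≢x
  neighbours-w : ∀ {q} → adjH w q ≡ true → q ∈ (u ∷ v ∷ [])
  neighbours-w = two-∈ ∘ T₁.neighbours-c ∘ adjH-old-at (u≢w ∘ sym) w≢x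
  neighbours-y : ∀ {q} → adjH y q ≡ true → q ∈ (x ∷ z ∷ [])
  neighbours-y = two-∈ ∘ T₂.neighbours-b ∘ adjH-old-at (u≢y ∘ sym) (x≢y ∘ sym)
  neighbours-z : ∀ {q} → adjH z q ≡ true → q ∈ (x ∷ y ∷ [])
  neighbours-z = two-∈ ∘ T₂.neighbours-c ∘ adjH-old-at (u≢z ∘ sym) (x≢z ∘ sym)

  Ts-closedH : Closed adjH Ts
  Ts-closedH p∈ e with adjH-split e
  ... | inj₁ old                = Ts-closed p∈ old
  ... | inj₂ (inj₁ (_ , refl)) = there (there (there (here refl)))
  ... | inj₂ (inj₂ (_ , refl)) = here refl

  rotH-u-cycle : rotH u v ≡ x × rotH u x ≡ w × rotH u w ≡ v
  rotH-u-cycle = trans (rotH-u v) rotU-v , trans (rotH-u x) rotU-x , trans (rotH-u w) rotU-w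

  rotH-x-cycle : rotH x y ≡ u × rotH x u ≡ z × rotH x z ≡ y
  rotH-x-cycle = trans (rotH-x y) rotX-y , trans (rotH-x u) rotX-u , trans (rotH-x z) rotX-z

  data Position (p : Fin n) : Set where
    at-u      : p ≡ u → Position p
    at-x      : p ≡ x → Position p
    elsewhere : p ≢ u → p ≢ x → Position p

  position : ∀ p → Position p
  position p with p ≟ u | p ≟ x
  ... | yes p≡u | _       = at-u p≡u
  ... | no _    | yes p≡x = at-x p≡x
  ... | no p≢u  | no p≢x  = elsewhere p≢u p≢x

  rotH-adj : ∀ p q → adjH p q ≡ true → adjH p (rotH p q) ≡ true
  rotH-adj p q e with position p
  ... | at-u refl with neighbours-u e
  ...   | here refl                 rewrite proj₁ rotH-u-cycle          = adjH-ux
  ...   | there (here refl)         rewrite proj₁ (proj₂ rotH-u-cycle) = adjH-old T₁.ac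
  ...   | there (there (here refl)) rewrite proj₂ (proj₂ rotH-u-cycle) = adjH-old T₁.ab
  rotH-adj p q e | at-x refl with neighbours-x e
  ...   | here refl                 rewrite proj₁ rotH-x-cycle          = adjH-xu
  ...   | there (here refl)         rewrite proj₁ (proj₂ rotH-x-cycle) = adjH-old T₂.ac
  ...   | there (there (here refl)) rewrite proj₂ (proj₂ rotH-x-cycle) = adjH-old T₂.ab
  rotH-adj p q e | elsewhere p≢u p≢x rewrite rotH-other q p≢u p≢x =
    adjH-old (rot-adj G p q (adjH-old-at p≢u p≢x e))

  rotH-injective : ∀ p q q′ → adjH p q ≡ true → adjH p q′ ≡ true → rotH p q ≡ rotH p q′ → q ≡ q′
  rotH-injective p q q′ e e′ r with position p
  ... | at-u refl = let (uv , ux , uw) = rotH-u-cycle in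
    three-cycle-injective (rotH u) uv ux uw (neighbours-u e) (neighbours-u e′) r
  ... | at-x refl = let (xy , xu , xz) = rotH-x-cycle in
    three-cycle-injective (rotH x) xy xu xz (neighbours-x e) (neighbours-x e′) r
  ... | elsewhere p≢u p≢x = rot-inj G p q q′ (adjH-old-at p≢u p≢x e) (adjH-old-at p≢u p≢x e′)
          (trans (sym (rotH-other q p≢u p≢x)) (trans r (rotH-other q′ p≢u p≢x)))

  rotH-cyclic : ∀ p q s → adjH p q ≡ true → adjH p s ≡ true → ∃ λ k → iter (rotH p) k q ≡ s
  rotH-cyclic p q s e e′ with position p
  ... | at-u refl = let (uv , ux , uw) = rotH-u-cycle in
    three-cycle-orbit (rotH u) uv ux uw (neighbours-u e) (neighbours-u e′)
  ... | at-x refl = let (xy , xu , xz) = rotH-x-cycle in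
    three-cycle-orbit (rotH x) xy xu xz (neighbours-x e) (neighbours-x e′)
  ... | elsewhere p≢u p≢x with rot-cyc G p q s (adjH-old-at p≢u p≢x e) (adjH-old-at p≢u p≢x e′)
  ...   | k , q⇝s = k , trans (iter-cong (λ t → rotH-other t p≢u p≢x) k q) q⇝s

  -- The only edge of H between the two triangles is ux, so ux lies on no triangle or 4-cycle of H.
  cross-edge : ∀ {p q} → adjH p q ≡ true → p ∈ T₁.vertices → q ∈ T₂.vertices → p ≡ u × q ≡ x
  cross-edge e p∈ q∈ with adjH-split e
  ... | inj₁ old                = ⊥-elim (disjoint (T₁.closed p∈ old) q∈)
  ... | inj₂ (inj₁ ux)          = ux
  ... | inj₂ (inj₂ (refl , _)) = ⊥-elim (disjoint p∈ (here refl))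

  beside-u : ∀ {q} → adjH u q ≡ true → q ≢ x → q ∈ T₁.vertices
  beside-u e q≢x with neighbours-u e
  ... | here q≡v                 = there (here q≡v)
  ... | there (here q≡x)         = ⊥-elim (q≢x q≡x)
  ... | there (there (here q≡w)) = there (there (here q≡w))

  beside-x : ∀ {q} → adjH x q ≡ true → q ≢ u → q ∈ T₂.vertices
  beside-x e q≢u with neighbours-x e
  ... | here q≡y                 = there (here q≡y)
  ... | there (here q≡u)         = ⊥-elim (q≢u q≡u)
  ... | there (there (here q≡z)) = there (there (here q≡z))

  ux-no-triangle : ∀ {c} → adjH u c ≡ true → adjH x c ≡ true → ⊥
  ux-no-triangle {c} uc xc =
    disjoint (beside-u uc (λ c≡x → loop (subst (λ t → adjH x t ≡ true) c≡x xc))) (beside-x xc (λ c≡u → loop (subst (λ t → adjH u t ≡ true) c≡u uc)))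
    where
    loop : ∀ {p} → adjH p p ≡ true → ⊥
    loop {p} pp = true≢false (trans (sym pp) (adjH-irrefl p))

  ux-no-square : ∀ {c d} → adjH x c ≡ true → adjH c d ≡ true → adjH d u ≡ true → c ≢ u → d ≢ x → ⊥
  ux-no-square xc cd du c≢u d≢x with cross-edge (adjH-flip cd) (beside-u (adjH-flip du) d≢x) (beside-x xc c≢u)
  ... | _ , refl = true≢false (trans (sym xc) (adjH-irrefl x))

  triangle-edge-old : ∀ {a b c} → adjH a b ≡ true → adjH b c ≡ true → adjH c a ≡ true → A a b ≡ true
  triangle-edge-old ab bc ca with adjH-split ab
  ... | inj₁ old                   = old
  ... | inj₂ (inj₁ (refl , refl)) = ⊥-elim (ux-no-triangle (adjH-flip ca) bc)
  ... | inj₂ (inj₂ (refl , refl)) = ⊥-elim (ux-no-triangle bc (adjH-flip ca))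

  square-edge-old : ∀ {a b c d} → adjH a b ≡ true → adjH b c ≡ true → adjH c d ≡ true → adjH d a ≡ true →
                    a ≢ c → b ≢ d → A a b ≡ true
  square-edge-old ab bc cd da a≢c b≢d with adjH-split ab
  ... | inj₁ old                   = old
  ... | inj₂ (inj₁ (refl , refl)) = ⊥-elim (ux-no-square bc cd da (a≢c ∘ sym) (b≢d ∘ sym))
  ... | inj₂ (inj₂ (refl , refl)) =
    ⊥-elim (ux-no-square (adjH-flip da) (adjH-flip cd) (adjH-flip bc) (b≢d ∘ sym) (a≢c ∘ sym))

  C3∪C4-freeH : C3∪C4-free A → C3∪C4-free adjH
  C3∪C4-freeH free (h , h-inj , e₀₁ , e₁₂ , e₂₀ , e₃₄ , e₄₅ , e₅₆ , e₆₃) =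
    free (h , h-inj ,
          triangle-edge-old e₀₁ e₁₂ e₂₀ , triangle-edge-old e₁₂ e₂₀ e₀₁ , triangle-edge-old e₂₀ e₀₁ e₁₂ ,
          square-edge-old e₃₄ e₄₅ e₅₆ e₆₃ 3≢5 4≢6 , square-edge-old e₄₅ e₅₆ e₆₃ e₃₄ 4≢6 (3≢5 ∘ sym) ,
          square-edge-old e₅₆ e₆₃ e₃₄ e₄₅ (3≢5 ∘ sym) (4≢6 ∘ sym) , square-edge-old e₆₃ e₃₄ e₄₅ e₅₆ (4≢6 ∘ sym) 3≢5)
    where
    3≢5 : h 3F ≢ h 5F
    3≢5 e with h-inj e
    ... | ()
    4≢6 : h 4F ≢ h 6F
    4≢6 e with h-inj e
    ... | ()

  hasNeighbour-same : ∀ p → hasNeighbour A p ≡ hasNeighbour adjH p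
  hasNeighbour-same p with position p
  ... | at-u refl = trans (has-neighbour A T₁.ab) (sym (has-neighbour adjH (adjH-old T₁.ab)))
  ... | at-x refl = trans (has-neighbour A T₂.ab) (sym (has-neighbour adjH (adjH-old T₂.ab)))
  ... | elsewhere p≢u p≢x = any-cong (allFin n) (λ q → sym (adjH-other q p≢u p≢x))

  vertexCount-same : nontrivVertexCount adjH ≡ nontrivVertexCount A
  vertexCount-same = sumFin-cong n (λ p → cong b2n (sym (hasNeighbour-same p)))

  edgeCountH : edgeCount adjH ≡ edgeCount A + 1
  edgeCountH with <-cmp (toℕ u) (toℕ x)
  ... | tri< u<x _ _ = edgeCount-insert A adjH u<x A-ux (λ _ _ → refl)
  ... | tri≈ _ u≡x _ = ⊥-elim (u≢x (Fin.toℕ-injective u≡x))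
  ... | tri> _ _ x<u = edgeCount-insert A adjH x<u (trans (adj-sym G x u) A-ux)
                         (λ p q → cong (A p q ∨_) (∨-comm (p == u ∧ q == x) (p == x ∧ q == u)))

  ∉Ts-≢u : ∀ {p} → p ∉ Ts → p ≢ u
  ∉Ts-≢u p∉ = p∉ ∘ here

  ∉Ts-≢x : ∀ {p} → p ∉ Ts → p ≢ x
  ∉Ts-≢x p∉ = p∉ ∘ there ∘ there ∘ there ∘ here

  reach-same : ∀ {p} → p ∉ Ts → ∀ q → reachB A n q p ≡ reachB adjH n q p
  reach-same p∉ q with q ∈? Ts
  ... | yes q∈ = trans (¬-not λ q⇝p → p∉ (reach-closed A (_∈ Ts) Ts-closed n q⇝p q∈))
                       (sym (¬-not λ q⇝p → p∉ (reach-closed adjH (_∈ Ts) Ts-closedH n q⇝p q∈)))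
  ... | no q∉  = reach-agree A adjH (_∉ Ts) outside-Ts (λ b a∉ → sym (adjH-other b (∉Ts-≢u a∉) (∉Ts-≢x a∉))) n _ q∉

  componentRep-same : ∀ {p} → p ∉ Ts → componentRep A p ≡ componentRep adjH p
  componentRep-same {p} p∉ = cong₂ _∧_ (hasNeighbour-same p)
    (cong not (any-cong (allFin n) λ q → cong ((toℕ q <ᵇ toℕ p) ∧_) (reach-same p∉ q)))

  componentsG-on-Ts : sumMap (b2n ∘ componentRep A) Ts ≡ 2
  componentsG-on-Ts =
    trans (sumMap-++ (b2n ∘ componentRep A) T₁.vertices T₂.vertices)
          (cong₂ _+_ (isolated-triangle-component T₁) (isolated-triangle-component T₂))

  module _ (4≤n : 4 ≤ n) where

    to-u : ∀ {q} → q ∈ Ts → reachB adjH 2 q u ≡ true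
    to-u (here refl)                                   = reach-refl adjH 2 u
    to-u (there (here refl))                           = reach-step adjH 1 (reach-refl adjH 1 _) (adjH-old T₁.ba)
    to-u (there (there (here refl)))                   = reach-step adjH 1 (reach-refl adjH 1 _) (adjH-old T₁.ca)
    to-u (there (there (there (here refl))))           = reach-step adjH 1 (reach-refl adjH 1 _) adjH-xu
    to-u (there (there (there (there (here refl)))))   = reach-step adjH 1 (reach-edge adjH (adjH-old T₂.ba)) adjH-xu
    to-u (there (there (there (there (there (here refl)))))) = reach-step adjH 1 (reach-edge adjH (adjH-old T₂.ca)) adjH-xu

    from-u : ∀ {p} → p ∈ Ts → reachB adjH 2 u p ≡ true
    from-u (here refl)                                   = reach-refl adjH 2 u
    from-u (there (here refl))                           = reach-step adjH 1 (reach-refl adjH 1 _) (adjH-old T₁.ab)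
    from-u (there (there (here refl)))                   = reach-step adjH 1 (reach-refl adjH 1 _) (adjH-old T₁.ac)
    from-u (there (there (there (here refl))))           = reach-step adjH 1 (reach-refl adjH 1 _) adjH-ux
    from-u (there (there (there (there (here refl)))))   = reach-step adjH 1 (reach-edge adjH adjH-ux) (adjH-old T₂.ab)
    from-u (there (there (there (there (there (here refl)))))) = reach-step adjH 1 (reach-edge adjH adjH-ux) (adjH-old T₂.ac)

    componentsH-on-Ts : sumMap (b2n ∘ componentRep adjH) Ts ≡ 1
    componentsH-on-Ts = componentRep-count adjH adjH-sym Ts Ts-distinct Ts-closedH neighbour
      (λ p∈ q∈ → reach-≤ adjH 4≤n (reach-++ adjH 2 2 (to-u q∈) (from-u p∈))) (here refl)
      where
      neighbour : ∀ {p} → p ∈ Ts → hasNeighbour adjH p ≡ true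
      neighbour p∈ with Ts-split p∈
      ... | inj₁ p∈T₁ = has-neighbour adjH (adjH-old (proj₂ (T₁.some-neighbour p∈T₁)))
      ... | inj₂ p∈T₂ = has-neighbour adjH (adjH-old (proj₂ (T₂.some-neighbour p∈T₂)))

    componentCount-drops : nontrivComponentCount A + 1 ≡ nontrivComponentCount adjH + 2
    componentCount-drops = begin
      nontrivComponentCount A + 1 ≡⟨ cong (nontrivComponentCount A +_) componentsH-on-Ts ⟨
      nontrivComponentCount A + sumMap (b2n ∘ componentRep adjH) Ts
        ≡⟨ sumFin-update-list n (b2n ∘ componentRep A) (b2n ∘ componentRep adjH) Ts Ts-distinct
             (λ p p∉ → cong b2n (componentRep-same p∉)) ⟩
      nontrivComponentCount adjH + sumMap (b2n ∘ componentRep A) Ts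
        ≡⟨ cong (nontrivComponentCount adjH +_) componentsG-on-Ts ⟩
      nontrivComponentCount adjH + 2 ∎
      where open ≡-Reasoning

    Outside : Dart n → Set
    Outside (p , q) = p ∉ Ts × A p q ≡ true

    outside-step : ∀ {d} → Outside d → Outside (faceStep (rot G) d) × faceStep rotH d ≡ faceStep (rot G) d
    outside-step {p , q} (p∉ , pq) =
      (q∉ , rot-adj G q p (edge-flip pq)) , cong (q ,_) (rotH-other p (∉Ts-≢u q∉) (∉Ts-≢x q∉))
      where
      q∉ : q ∉ Ts
      q∉ = outside-Ts p∉ pq

    outside-walk : ∀ {d} → Outside d → ∀ k →
                   Outside (iter (faceStep (rot G)) k d) × iter (faceStep rotH) k d ≡ iter (faceStep (rot G)) k d
    outside-walk out zero    = out , refl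
    outside-walk out (suc k) = let (out′ , same) = outside-walk out k in
      proj₁ (outside-step out′) , trans (cong (faceStep rotH) same) (proj₂ (outside-step out′))

    faceRep-same : ∀ {p} q → p ∉ Ts → isFaceRep A (rot G) (p , q) ≡ isFaceRep adjH rotH (p , q)
    faceRep-same {p} q p∉ rewrite adjH-other q (∉Ts-≢u p∉) (∉Ts-≢x p∉) with A p q in pq
    ... | false = refl
    ... | true  = all-cong (upTo (n * n)) λ k →
                    cong (λ d → dartKey (p , q) ≤ᵇ dartKey d) (sym (proj₂ (outside-walk (p∉ , pq) k)))

    rowG rowH : Fin n → ℕ
    rowG p = countFin n (λ q → isFaceRep A (rot G) (p , q))
    rowH p = countFin n (λ q → isFaceRep adjH rotH (p , q))

    repG repH : Fin n → Fin n → ℕ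
    repG p q = b2n (isFaceRep A (rot G) (p , q))
    repH p q = b2n (isFaceRep adjH rotH (p , q))

    8≤n*n : 8 ≤ n * n
    8≤n*n = ≤-trans (m≤m+n 8 8) (*-mono-≤ 4≤n 4≤n)

    step-dartG : ∀ {d} → IsDart A d → IsDart A (faceStep (rot G) d)
    step-dartG {p , q} pq = rot-adj G q p (edge-flip pq)

    step-dartH : ∀ {d} → IsDart adjH d → IsDart adjH (faceStep rotH d)
    step-dartH {p , q} pq = rotH-adj q p (adjH-flip pq)

    pair : {p q : Fin n} → p ≢ q → AllPairs _≢_ (p ∷ q ∷ [])
    pair p≢q = (p≢q ∷ []) ∷ [] ∷ []

    facesG-on-Ts : sumMap rowG Ts ≡ 4
    facesG-on-Ts = trans
      (cong₂ _+_ (faceRep-row A (rot G) u _ (pair v≢w) (two-∈ ∘ T₁.neighbours-a))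
      (cong₂ _+_ (faceRep-row A (rot G) v _ (pair u≢w) (two-∈ ∘ T₁.neighbours-b))
      (cong₂ _+_ (faceRep-row A (rot G) w _ (pair u≢v) (two-∈ ∘ T₁.neighbours-c))
      (cong₂ _+_ (faceRep-row A (rot G) x _ (pair y≢z) (two-∈ ∘ T₂.neighbours-a))
      (cong₂ _+_ (faceRep-row A (rot G) y _ (pair x≢z) (two-∈ ∘ T₂.neighbours-b))
      (cong₂ _+_ (faceRep-row A (rot G) z _ (pair x≢y) (two-∈ ∘ T₂.neighbours-c)) refl))))))
      (trans (regroup (repG u v) (repG u w) (repG v u) (repG v w) (repG w u) (repG w v)
                      (repG x y) (repG x z) (repG y x) (repG y z) (repG z x) (repG z y))
        (cong₂ _+_ (triangle-face A (rot G) step-dartG 3≤n*n T₁.ab T₁.rot-ba T₁.rot-cb T₁.rot-ac u≢v v≢w u≢w)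
        (cong₂ _+_ (triangle-face A (rot G) step-dartG 3≤n*n T₁.ba T₁.rot-ab T₁.rot-ca T₁.rot-bc (u≢v ∘ sym) u≢w v≢w)
        (cong₂ _+_ (triangle-face A (rot G) step-dartG 3≤n*n T₂.ab T₂.rot-ba T₂.rot-cb T₂.rot-ac x≢y y≢z x≢z)
                   (triangle-face A (rot G) step-dartG 3≤n*n T₂.ba T₂.rot-ab T₂.rot-ca T₂.rot-bc (x≢y ∘ sym) x≢z y≢z)))))
      where
      3≤n*n : 3 ≤ n * n
      3≤n*n = ≤-trans (m≤m+n 3 5) 8≤n*n
      regroup : ∀ a b c d e f g h i j k l →
        (a + (b + 0)) + ((c + (d + 0)) + ((e + (f + 0)) + ((g + (h + 0)) + ((i + (j + 0)) + ((k + (l + 0)) + 0))))) ≡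
        (a + (d + (e + 0))) + ((c + (b + (f + 0))) + ((g + (j + (k + 0))) + (i + (h + (l + 0)))))
      regroup = solve-∀

    -- the face of H which merges the faces v u w and y x z of G
    joinedFace : ℕ → Dart n
    joinedFace 0 = v , u
    joinedFace 1 = u , x
    joinedFace 2 = x , z
    joinedFace 3 = z , y
    joinedFace 4 = y , x
    joinedFace 5 = x , u
    joinedFace 6 = u , w
    joinedFace 7 = w , v
    joinedFace _ = v , u

    joined-face : sumMap (b2n ∘ isFaceRep adjH rotH) (applyUpTo joinedFace 8) ≡ 1
    joined-face = faceRep-cycle adjH rotH step-dartH joinedFace 8 (s≤s z≤n) step refl 8≤n*n (adjH-old T₁.ba)
      ((≢-fst (u≢v ∘ sym) ∷ ≢-fst v≢x ∷ ≢-fst v≢z ∷ ≢-fst v≢y ∷ ≢-fst v≢x ∷ ≢-fst (u≢v ∘ sym) ∷ ≢-fst v≢w ∷ []) ∷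
       (≢-fst u≢x ∷ ≢-fst u≢z ∷ ≢-fst u≢y ∷ ≢-fst u≢x ∷ ≢-snd (w≢x ∘ sym) ∷ ≢-fst u≢w ∷ []) ∷
       (≢-fst x≢z ∷ ≢-fst x≢y ∷ ≢-snd (u≢z ∘ sym) ∷ ≢-fst (u≢x ∘ sym) ∷ ≢-fst (w≢x ∘ sym) ∷ []) ∷
       (≢-fst (y≢z ∘ sym) ∷ ≢-fst (x≢z ∘ sym) ∷ ≢-fst (u≢z ∘ sym) ∷ ≢-fst (w≢z ∘ sym) ∷ []) ∷
       (≢-fst (x≢y ∘ sym) ∷ ≢-fst (u≢y ∘ sym) ∷ ≢-fst (w≢y ∘ sym) ∷ []) ∷
       (≢-fst (u≢x ∘ sym) ∷ ≢-fst (w≢x ∘ sym) ∷ []) ∷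
       (≢-fst u≢w ∷ []) ∷ [] ∷ [])
      where
      step : ∀ {i} → i < 8 → faceStep rotH (joinedFace i) ≡ joinedFace (suc i)
      step {0} _ = cong (u ,_) (proj₁ rotH-u-cycle)
      step {1} _ = cong (x ,_) (proj₁ (proj₂ rotH-x-cycle))
      step {2} _ = cong (z ,_) (trans (rotH-other x (u≢z ∘ sym) (x≢z ∘ sym)) T₂.rot-ca)
      step {3} _ = cong (y ,_) (trans (rotH-other z (u≢y ∘ sym) (x≢y ∘ sym)) T₂.rot-bc)
      step {4} _ = cong (x ,_) (proj₁ rotH-x-cycle)
      step {5} _ = cong (u ,_) (proj₁ (proj₂ rotH-u-cycle))
      step {6} _ = cong (w ,_) (trans (rotH-other u (u≢w ∘ sym) w≢x) T₁.rot-ca)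
      step {7} _ = cong (v ,_) (trans (rotH-other w (u≢v ∘ sym) v≢x) T₁.rot-bc)
      step {suc (suc (suc (suc (suc (suc (suc (suc _)))))))} (s≤s (s≤s (s≤s (s≤s (s≤s (s≤s (s≤s (s≤s ()))))))))

    facesH-on-Ts : sumMap rowH Ts ≡ 3
    facesH-on-Ts = trans
      (cong₂ _+_ (faceRep-row adjH rotH u _ triple-u neighbours-u)
      (cong₂ _+_ (faceRep-row adjH rotH v _ (pair u≢w) neighbours-v)
      (cong₂ _+_ (faceRep-row adjH rotH w _ (pair u≢v) neighbours-w)
      (cong₂ _+_ (faceRep-row adjH rotH x _ triple-x neighbours-x)
      (cong₂ _+_ (faceRep-row adjH rotH y _ (pair x≢z) neighbours-y)
      (cong₂ _+_ (faceRep-row adjH rotH z _ (pair x≢y) neighbours-z) refl))))))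
      (trans (regroup (repH u v) (repH u x) (repH u w) (repH v u) (repH v w) (repH w u) (repH w v)
                      (repH x y) (repH x u) (repH x z) (repH y x) (repH y z) (repH z x) (repH z y))
        (cong₂ _+_ (triangle-face adjH rotH step-dartH 3≤n*n (adjH-old T₁.ab)
                      (trans (rotH-other u (u≢v ∘ sym) v≢x) T₁.rot-ba) (trans (rotH-other v (u≢w ∘ sym) w≢x) T₁.rot-cb)
                      (proj₂ (proj₂ rotH-u-cycle)) u≢v v≢w u≢w)
        (cong₂ _+_ joined-face
                   (triangle-face adjH rotH step-dartH 3≤n*n (adjH-old T₂.ab)
                      (trans (rotH-other x (u≢y ∘ sym) (x≢y ∘ sym)) T₂.rot-ba)
                      (trans (rotH-other y (u≢z ∘ sym) (x≢z ∘ sym)) T₂.rot-cb)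
                      (proj₂ (proj₂ rotH-x-cycle)) x≢y y≢z x≢z))))
      where
      3≤n*n : 3 ≤ n * n
      3≤n*n = ≤-trans (m≤m+n 3 5) 8≤n*n
      triple-u : AllPairs _≢_ (v ∷ x ∷ w ∷ [])
      triple-u = (v≢x ∷ v≢w ∷ []) ∷ ((w≢x ∘ sym) ∷ []) ∷ [] ∷ []
      triple-x : AllPairs _≢_ (y ∷ u ∷ z ∷ [])
      triple-x = ((u≢y ∘ sym) ∷ y≢z ∷ []) ∷ (u≢z ∷ []) ∷ [] ∷ []
      regroup : ∀ a b c d e f g h i j k l m o →
        (a + (b + (c + 0))) + ((d + (e + 0)) + ((f + (g + 0)) + ((h + (i + (j + 0))) + ((k + (l + 0)) + ((m + (o + 0)) + 0))))) ≡
        (a + (e + (f + 0))) + ((d + (b + (j + (o + (k + (i + (c + (g + 0)))))))) + (h + (l + (m + 0))))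
      regroup = solve-∀

    faceCount-drops : faceCount A (rot G) + 3 ≡ faceCount adjH rotH + 4
    faceCount-drops = begin
      faceCount A (rot G) + 3              ≡⟨ cong (faceCount A (rot G) +_) facesH-on-Ts ⟨
      faceCount A (rot G) + sumMap rowH Ts ≡⟨ sumFin-update-list n rowG rowH Ts Ts-distinct
                                                (λ p p∉ → sumFin-cong n (λ q → cong b2n (faceRep-same q p∉))) ⟩
      faceCount adjH rotH + sumMap rowG Ts ≡⟨ cong (faceCount adjH rotH +_) facesG-on-Ts ⟩
      faceCount adjH rotH + 4              ∎
      where open ≡-Reasoning

    eulerH : nontrivVertexCount adjH + faceCount adjH rotH ≡ edgeCount adjH + 2 * nontrivComponentCount adjH
    eulerH = trans (cong (_+ faceCount adjH rotH) vertexCount-same)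
                   (euler-arith (euler G) faceCount-drops componentCount-drops edgeCountH)

    H : PlaneGraph n
    H = record { adj = adjH ; sym = adjH-sym ; irrefl = adjH-irrefl ; rot = rotH ; rot-adj = rotH-adj
               ; rot-inj = rotH-injective ; rot-cyc = rotH-cyclic ; euler = eulerH }

    not-extremal : IsExtremal G → ⊥
    not-extremal (free , maximal) =
      m+1+n≰m (edgeCount A) (subst (_≤ edgeCount A) edgeCountH (maximal H (C3∪C4-freeH free)))

module InteriorEdges {n : ℕ} (G : PlaneGraph n) where
  open Plane G

  three-face : ∀ {u v} → OnThreeFace G (u , v) → rot G (rot G v u) v ≡ u × rot G u (rot G v u) ≡ v
  three-face {u} {v} (_ , closes) =
    a→u , trans (cong (λ t → rot G t (rot G v u)) (sym a→u)) (,-injectiveʳ closes)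
    where
    a→u : rot G (rot G v u) v ≡ u
    a→u = ,-injectiveˡ closes

  interior-triangle : ∀ {u v} → InteriorEdge G u v → rot G v u ≡ rot G u v → IsolatedTriangle u v (rot G v u)
  interior-triangle {u} {v} (face , face′) a≡b = record
    { ab     = proj₁ face
    ; rot-ab = sym a≡b
    ; rot-ac = proj₂ (three-face face)
    ; rot-ba = refl
    ; rot-bc = trans (cong (rot G v) a≡b) (proj₂ (three-face face′))
    ; rot-ca = trans (cong (λ t → rot G t u) a≡b) (proj₁ (three-face face′))
    ; rot-cb = proj₁ (three-face face)
    }

  interior-diamond : ∀ {u v} → InteriorEdge G u v → rot G v u ≢ rot G u v → Diamond u v (rot G v u) (rot G u v)
  interior-diamond {u} {v} (face , face′) a≢b = record
    { uv  = uv
    ; ua  = edge-flip (rot-edge (edge-flip va) (proj₁ (three-face face)))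
    ; va  = va
    ; ub  = ub
    ; vb  = edge-flip (rot-edge (edge-flip ub) (proj₁ (three-face face′)))
    ; a≢b = a≢b
    }
    where
    uv : A u v ≡ true
    uv = proj₁ face
    va : A v (rot G v u) ≡ true
    va = rot-adj G v u (edge-flip uv)
    ub : A u (rot G u v) ≡ true
    ub = rot-adj G u v uv

  in-theta : ∀ {u v p} → p ∈ (u ∷ rot G v u ∷ v ∷ rot G u v ∷ []) → InTheta G u v p
  in-theta (here refl)                        = inj₁ (0F , refl)
  in-theta (there (here refl))                = inj₁ (2F , refl)
  in-theta (there (there (here refl)))        = inj₁ (1F , refl)
  in-theta (there (there (there (here refl)))) = inj₂ (2F , refl)

open InteriorEdges

lemma3 : (n : ℕ) → 20 ≤ n → (G : PlaneGraph n) → IsExtremal G →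
    (u v x y : Fin n) → InteriorEdge G u v → InteriorEdge G x y →
    u ≢ x → u ≢ y → v ≢ x → v ≢ y →
    ThetaMeetTwice G u v x y
lemma3 n 20≤n G (free , maximal) u v x y e f u≢x u≢y v≢x v≢y
  with rot G v u ≟ rot G u v | rot G y x ≟ rot G x y
... | no a≢b  | no c≢d  =
  [ meet , ⊥-elim ∘ free ]′
    (Plane.diamonds-share-two G (interior-diamond G e a≢b) (interior-diamond G f c≢d) u≢x u≢y v≢x v≢y)
  where
  meet : ShareTwo _ _ → ThetaMeetTwice G u v x y
  meet (p , q , p≢q , p∈E , p∈F , q∈E , q∈F) =
    p , q , p≢q , in-theta G p∈E , in-theta G p∈F , in-theta G q∈E , in-theta G q∈F
... | yes a≡b | no c≢d  = ⊥-elim (free (Plane.isolated-triangle-beside-diamond G (interior-triangle G e a≡b)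
                            u≢x u≢y v≢x v≢y (interior-diamond G f c≢d)))
... | no a≢b  | yes c≡d = ⊥-elim (free (Plane.isolated-triangle-beside-diamond G (interior-triangle G f c≡d)
                            (u≢x ∘ sym) (v≢x ∘ sym) (u≢y ∘ sym) (v≢y ∘ sym) (interior-diamond G e a≢b)))
... | yes a≡b | yes c≡d = ⊥-elim (JoinIsolatedTriangles.not-extremal G T₁ T₂
                            (Plane.isolated-triangles-disjoint G T₁ u≢x u≢y v≢x v≢y T₂)
                            (≤-trans (m≤m+n 4 16) 20≤n) (free , maximal))
  where
  T₁ : Plane.IsolatedTriangle G u v (rot G v u)
  T₁ = interior-triangle G e a≡b
  T₂ : Plane.IsolatedTriangle G x y (rot G y x)
  T₂ = interior-triangle G f c≡d
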